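{- Let $\mathbb K$ be a field of characteristic zero, $n\leq 5$ and $2<r<n$. Let $E$ be the edge set of the complete graph $K_n$, $N=\#E$, identified with $\{1,\ldots,N\}$. Let $M^r_{K_n}$ be the matroid on $E$ whose bases are the edge sets of forests in $K_n$ with exactly $r$ edges, $\Phi=\sum_B\prod_{b\in B}x_b$ (sum over bases), and $A=\mathbb K[x_1,\ldots,x_N]/\mathrm{Ann}(\Phi)=\bigoplus_{j=0}^rA_j$. Then $A$ has the strong Lefschetz property, and $x_1+\cdots+x_N$ is a strong Lefschetz element.
   Context: $\mathrm{Ann}(\Phi)=\{P\in\mathbb K[x_1,\ldots,x_N]: P(\partial/\partial x_1,\ldots,\partial/\partial x_N)\Phi=0\}$; $A_j$ is the degree-$j$ component of the graded algebra $A$, with $A_r\neq 0$ and $A_j=0$ for $j>r$. A graded Artinian algebra $A=\bigoplus_{j=0}^sA_j$ with $A_s\neq0$ has the strong Lefschetz property if there is $L\in A_1$ such that multiplication by $L^{s-2j}\colon A_j\to A_{s-j}$ is bijective for all $j\leq s/2$; such $L$ is a strong Lefschetz element. -}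

module Defs where

open import Level using (Level; _⊔_)
open import Algebra.Bundles using (CommutativeRing)
open import Data.Nat using (ℕ; zero; suc; _+_; _∸_; _≤_; _<_)
open import Data.Fin using (Fin; zero; suc; inject₁; fromℕ)
open import Data.Fin.Subset using (Subset; ∣_∣)
open import Data.Bool using (Bool; true; false; if_then_else_)
open import Data.Product using (_×_; _,_; ∃; ∃-syntax; Σ)
open import Data.Sum using (_⊎_)
open import Data.List as List using (List; []; _∷_; _++_)
open import Data.Vec as Vec using (Vec; lookup; allFin; replicate; zipWith; updateAt)
open import Function.Definitions using (Injective)
open import Relation.Binary.PropositionalEquality using (_≡_)
open import Relation.Nullary using (¬_)

-- Edges of K_n, listed as pairs (i , j) with i < j; an edge is identified
-- with its position in this list, i.e. E = Fin (#E).
edges : (n : ℕ) → List (Fin n × Fin n)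
edges zero    = []
edges (suc n) = List.map (λ j → (zero , suc j)) (Vec.toList (allFin n))
             ++ List.map (λ { (i , j) → (suc i , suc j) }) (edges n)

#E : ℕ → ℕ
#E n = List.length (edges n)

Edge : ℕ → Set
Edge n = Fin (#E n)

edgeEnds : (n : ℕ) → Edge n → Fin n × Fin n
edgeEnds n e = List.lookup (edges n) e

Adj : (n : ℕ) → Subset (#E n) → Fin n → Fin n → Set
Adj n S a b = ∃[ e ] ((edgeEnds n e ≡ (a , b) ⊎ edgeEnds n e ≡ (b , a))
                      × lookup S e ≡ true)

-- a cycle: pairwise distinct vertices v_0, …, v_{m+2} (length ≥ 3) with
-- v_i v_{i+1} ∈ S and v_{m+2} v_0 ∈ S
record Cycle (n : ℕ) (S : Subset (#E n)) : Set where
  field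
    m      : ℕ
    v      : Fin (suc (suc (suc m))) → Fin n
    v-inj  : Injective _≡_ _≡_ v
    steps  : (i : Fin (suc (suc m))) → Adj n S (v (inject₁ i)) (v (suc i))
    close  : Adj n S (v (fromℕ (suc (suc m)))) (v zero)

IsForest : (n : ℕ) → Subset (#E n) → Set
IsForest n S = ¬ Cycle n S

IsBasis : (n r : ℕ) → Subset (#E n) → Set
IsBasis n r B = (∣ B ∣ ≡ r) × IsForest n B

Mono : ℕ → Set
Mono N = Vec ℕ N

sqfree : ∀ {N} → Subset N → Mono N
sqfree B = Vec.map (λ b → if b then 1 else 0) B

deg : ∀ {N} → Mono N → ℕ
deg α = Vec.foldr _ _+_ 0 α

iter : ∀ {a} {A : Set a} → ℕ → (A → A) → A → A
iter zero    f x = x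
iter (suc k) f x = f (iter k f x)

module Poly {c ℓ : Level} (R : CommutativeRing c ℓ) where
  open CommutativeRing R renaming (_+_ to _+ᴷ_)
  open import Algebra.Properties.Semiring.Mult semiring using () renaming (_×_ to _·_)

  IsField : Set (c ⊔ ℓ)
  IsField = (¬ (1# ≈ 0#)) × (∀ x → ¬ (x ≈ 0#) → ∃[ y ] (x * y ≈ 1#))

  CharZero : Set ℓ
  CharZero = ∀ k → ¬ ((suc k · 1#) ≈ 0#)

  Pol : ℕ → Set c
  Pol N = List (Carrier × Mono N)

  -- an (arbitrary, possibly infinite formal) power series / polynomial given
  -- by its coefficient function; used for Φ and its derivatives
  Coeffs : ℕ → Set c
  Coeffs N = Mono N → Carrier

  -- ∂/∂x_i on coefficient functions: coefficient of x^β in ∂_i f is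
  -- (β_i + 1) · (coefficient of x^{β + e_i} in f)
  ∂ : ∀ {N} → Fin N → Coeffs N → Coeffs N
  ∂ i f β = (suc (lookup β i) · 1#) * f (updateAt β i suc)

  ∂^ : ∀ {N} → Mono N → Coeffs N → Coeffs N
  ∂^ {N} α f = Vec.foldr _ (λ i g → iter (lookup α i) (∂ i) g) f (allFin N)

  act : ∀ {N} → Pol N → Coeffs N → Coeffs N
  act []            f β = 0#
  act ((a , α) ∷ P) f β = (a * ∂^ α f β) +ᴷ act P f β

  Ann : ∀ {N} → Coeffs N → Pol N → Set ℓ
  Ann Φ P = ∀ β → act P Φ β ≈ 0#

  Homog : ∀ {N} → ℕ → Pol N → Set
  Homog j []            = Data.Unit.⊤ where import Data.Unit
  Homog j ((a , α) ∷ P) = (deg α ≡ j) × Homog j P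

  _⊕_ : ∀ {N} → Pol N → Pol N → Pol N
  P ⊕ Q = P ++ Q

  ⊝_ : ∀ {N} → Pol N → Pol N
  ⊝ P = List.map (λ { (a , α) → (- a , α) }) P

  _⊗_ : ∀ {N} → Pol N → Pol N → Pol N
  P ⊗ Q = List.concatMap (λ { (a , α) → List.map (λ { (b , β) → (a * b , zipWith _+_ α β) }) Q }) P

  one : ∀ {N} → Pol N
  one {N} = (1# , replicate N 0) ∷ []

  _^'_ : ∀ {N} → Pol N → ℕ → Pol N
  L ^' k = iter k (L ⊗_) one

  var : ∀ {N} → Fin N → Pol N
  var {N} i = (1# , updateAt (replicate N 0) i suc) ∷ []

  linear : ∀ {N} → (Fin N → Carrier) → Pol N
  linear {N} a = Vec.toList (Vec.map (λ i → (a i , updateAt (replicate N 0) i suc)) (allFin N))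

  sumVars : ∀ {N} → Pol N
  sumVars = linear (λ _ → 1#)

  -- A = K[x]/Ann(Φ), A_j = (homogeneous degree-j polynomials)/Ann(Φ)_j.
  -- A_s ≠ 0 and A_j = 0 for j > s
  IsTopDegree : ∀ {N} → Coeffs N → ℕ → Set (c ⊔ ℓ)
  IsTopDegree Φ s = (∃[ P ] (Homog s P × ¬ Ann Φ P))
                  × (∀ j → s < j → ∀ P → Homog j P → Ann Φ P)

  MulBijective : ∀ {N} → Coeffs N → Pol N → ℕ → ℕ → Set (c ⊔ ℓ)
  MulBijective Φ L k j =
      (∀ P → Homog j P → Ann Φ ((L ^' k) ⊗ P) → Ann Φ P)
    × (∀ Q → Homog (j + k) Q → ∃[ P ] (Homog j P × Ann Φ (Q ⊕ (⊝ ((L ^' k) ⊗ P)))))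

  IsStrongLefschetzElement : ∀ {N} → Coeffs N → Pol N → Set (c ⊔ ℓ)
  IsStrongLefschetzElement Φ L =
    Homog 1 L ×
    ∃[ s ] (IsTopDegree Φ s × (∀ j → j + j ≤ s → MulBijective Φ L (s ∸ (j + j)) j))

  HasSLP : ∀ {N} → Coeffs N → Set (c ⊔ ℓ)
  HasSLP {N} Φ = ∃[ L ] IsStrongLefschetzElement {N} Φ L

  IsBasisGenPoly : (n r : ℕ) → Coeffs (#E n) → Set ℓ
  IsBasisGenPoly n r Φ =
    ∀ γ → ((∃[ B ] (γ ≡ sqfree B × IsBasis n r B)) → Φ γ ≈ 1#)
        × (¬ (∃[ B ] (γ ≡ sqfree B × IsBasis n r B)) → Φ γ ≈ 0#)

-- Since Φ is multilinear, the derivative ∂^α Φ is just the shift β ↦ Φ (α + β), so P(∂) Φ only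
-- involves the numbers χ γ ∈ {0, 1} of bases with ∏_{b ∈ B} x_b = x^γ, and everything reduces to
-- integer matrices. In monomial bases, multiplication by L^{r-2j} : A_j → A_{r-j} is represented by
-- the matrix of word sums Σ_w χ (x^w xᵢ xₘ) over words w of length r − 2j. As r ≤ 4, only j ≤ 2
-- occurs and j = 2 means multiplication by L⁰. For j = 0 the matrix is the number r! · #bases ≠ 0;
-- for j = 1 an explicit integer matrix G with G H = H G = (d + 1) I inverts it in characteristic 0.
-- The bases of M^r_{K_n} are tabulated: each tabulated r-set of edges is shown to be a forest by
-- peeling off leaves, and every other r-set to contain one of a list of triangles and 4-cycles.

module Submission where

open import Defs
open import Level using (Level)
open import Algebra.Bundles using (CommutativeRing)
open import Data.Nat using (ℕ; zero; suc; _+_; _∸_; _≤_; _<_; s≤s; z≤n)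
import Data.Nat as ℕ
import Data.Nat.Properties as ℕₚ
open import Algebra.Properties.Semiring.Sum ℕₚ.+-*-semiring using () renaming (sum to sumℕ)
open import Data.Fin using (Fin; zero; suc; inject₁; fromℕ; #_)
import Data.Fin.Properties as Fin
open import Data.Fin.Relation.Unary.Top using (view; ‵fromℕ; ‵inject₁)
open import Data.Fin.Subset using (Subset; ∣_∣)
open import Data.Bool using (Bool; true; false; _∧_; _∨_; not; if_then_else_; T; T?)
import Data.Bool.Properties as Bool
open import Data.Vec using (Vec; []; _∷_; lookup; updateAt; replicate; zipWith; allFin; tabulate)
import Data.Vec as Vec
import Data.Vec.Properties as Vecₚ
open import Data.List using (List; []; _∷_; _++_)
import Data.List as List
open import Data.Product using (Σ; ∃-syntax; _×_; _,_; proj₁; proj₂)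
import Data.Product.Properties as Product
open import Data.Sum using (inj₁; inj₂)
open import Data.Unit using (tt)
open import Data.Empty using (⊥-elim)
open import Function using (_∘_)
open import Relation.Nullary using (¬_; Dec; yes; no; does)
open import Relation.Nullary.Decidable using (_×-dec_; _⊎-dec_; _→-dec_; map′)
open import Relation.Unary using (Decidable)
import Relation.Binary.PropositionalEquality as ≡
open ≡ using (_≡_; _≢_)

all²? : ∀ {N} {P : Fin N → Fin N → Set} → (∀ i j → Dec (P i j)) → Dec (∀ i j → P i j)
all²? P? = Fin.all? λ i → Fin.all? λ j → P? i j

module Monomial where

  open ≡ using (refl; cong; cong₂; sym; trans; module ≡-Reasoning)
  open import Algebra.Properties.CommutativeSemigroup ℕₚ.+-commutativeSemigroup
    using () renaming (interchange to +-interchange)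

  infixl 6 _⊞_
  _⊞_ : ∀ {N} → Mono N → Mono N → Mono N
  _⊞_ = zipWith _+_

  0ᵐ : ∀ {N} → Mono N
  0ᵐ = replicate _ 0

  unit : ∀ {N} → Fin N → Mono N
  unit i = updateAt 0ᵐ i suc

  ⊞-identityˡ : ∀ {N} (α : Mono N) → 0ᵐ ⊞ α ≡ α
  ⊞-identityˡ []      = refl
  ⊞-identityˡ (a ∷ α) = cong (a ∷_) (⊞-identityˡ α)

  ⊞-identityʳ : ∀ {N} (α : Mono N) → α ⊞ 0ᵐ ≡ α
  ⊞-identityʳ []      = refl
  ⊞-identityʳ (a ∷ α) = cong₂ _∷_ (ℕₚ.+-identityʳ a) (⊞-identityʳ α)

  deg-⊞ : ∀ {N} (α β : Mono N) → deg (α ⊞ β) ≡ deg α + deg β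
  deg-⊞ []      []      = refl
  deg-⊞ (a ∷ α) (b ∷ β) = begin
    (a + b) + deg (α ⊞ β)     ≡⟨ cong ((a + b) +_) (deg-⊞ α β) ⟩
    (a + b) + (deg α + deg β) ≡⟨ +-interchange a b (deg α) (deg β) ⟩
    (a + deg α) + (b + deg β) ∎
    where open ≡-Reasoning

  deg-0ᵐ : ∀ {N} → deg (0ᵐ {N}) ≡ 0
  deg-0ᵐ {zero}  = refl
  deg-0ᵐ {suc N} = deg-0ᵐ {N}

  deg-unit : ∀ {N} (i : Fin N) → deg (unit i) ≡ 1
  deg-unit {suc N} zero    = cong suc (deg-0ᵐ {N})
  deg-unit         (suc i) = deg-unit i

  deg≡0⇒0ᵐ : ∀ {N} (α : Mono N) → deg α ≡ 0 → α ≡ 0ᵐ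
  deg≡0⇒0ᵐ []         _  = refl
  deg≡0⇒0ᵐ (zero ∷ α) eq = cong (0 ∷_) (deg≡0⇒0ᵐ α eq)

  deg≡1⇒unit : ∀ {N} (α : Mono N) → deg α ≡ 1 → ∃[ i ] α ≡ unit i
  deg≡1⇒unit (zero ∷ α) eq with deg≡1⇒unit α eq
  ... | i , refl = suc i , refl
  deg≡1⇒unit (suc zero ∷ α) eq = zero , cong (1 ∷_) (deg≡0⇒0ᵐ α (ℕₚ.suc-injective eq))

  -- adds k to βᵢ by the same recursion as iter k (∂ i)
  shiftAt : ∀ {N} → Mono N → Fin N → ℕ → Mono N
  shiftAt β i zero    = β
  shiftAt β i (suc k) = shiftAt (updateAt β i suc) i k

  shiftAlong : ∀ {N m} → Mono N → Vec (Fin N) m → Mono N → Mono N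
  shiftAlong α []       β = β
  shiftAlong α (i ∷ is) β = shiftAlong α is (shiftAt β i (lookup α i))

  lookup-updateAt-suc : ∀ {N} (γ : Mono N) i j → lookup γ j ≤ lookup (updateAt γ i suc) j
  lookup-updateAt-suc (x ∷ γ) zero    zero    = ℕₚ.n≤1+n x
  lookup-updateAt-suc (x ∷ γ) zero    (suc j) = ℕₚ.≤-refl
  lookup-updateAt-suc (x ∷ γ) (suc i) zero    = ℕₚ.≤-refl
  lookup-updateAt-suc (x ∷ γ) (suc i) (suc j) = lookup-updateAt-suc γ i j

  lookup-shiftAt : ∀ {N} k (γ : Mono N) i j → lookup γ j ≤ lookup (shiftAt γ i k) j
  lookup-shiftAt zero    γ i j = ℕₚ.≤-refl
  lookup-shiftAt (suc k) γ i j =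
    ℕₚ.≤-trans (lookup-updateAt-suc γ i j) (lookup-shiftAt k (updateAt γ i suc) i j)

  lookup-shiftAlong : ∀ {N m} (α : Mono N) (is : Vec (Fin N) m) γ j →
                      lookup γ j ≤ lookup (shiftAlong α is γ) j
  lookup-shiftAlong α []       γ j = ℕₚ.≤-refl
  lookup-shiftAlong α (i ∷ is) γ j =
    ℕₚ.≤-trans (lookup-shiftAt (lookup α i) γ i j) (lookup-shiftAlong α is _ j)

  shiftAt-zero : ∀ {N} k b (β : Mono N) → shiftAt (b ∷ β) zero k ≡ (k + b) ∷ β
  shiftAt-zero zero    b β = refl
  shiftAt-zero (suc k) b β = trans (shiftAt-zero k (suc b) β) (cong (_∷ β) (ℕₚ.+-suc k b))

  shiftAt-suc : ∀ {N} k b (β : Mono N) i → shiftAt (b ∷ β) (suc i) k ≡ b ∷ shiftAt β i k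
  shiftAt-suc zero    b β i = refl
  shiftAt-suc (suc k) b β i = shiftAt-suc k b (updateAt β i suc) i

  shiftAlong-map-suc : ∀ {N m} a (α : Mono N) (is : Vec (Fin N) m) b β →
    shiftAlong (a ∷ α) (Vec.map suc is) (b ∷ β) ≡ b ∷ shiftAlong α is β
  shiftAlong-map-suc a α []       b β = refl
  shiftAlong-map-suc a α (i ∷ is) b β =
    trans (cong (shiftAlong (a ∷ α) (Vec.map suc is)) (shiftAt-suc (lookup α i) b β i))
          (shiftAlong-map-suc a α is b (shiftAt β i (lookup α i)))

  shiftAlong-allFin : ∀ {N} (α β : Mono N) → shiftAlong α (allFin N) β ≡ α ⊞ β
  shiftAlong-allFin []      []      = refl
  shiftAlong-allFin {suc N} (a ∷ α) (b ∷ β) = begin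
    shiftAlong (a ∷ α) (tabulate suc) (shiftAt (b ∷ β) zero a)
      ≡⟨ cong₂ (shiftAlong (a ∷ α)) (Vecₚ.tabulate-allFin suc) (shiftAt-zero a b β) ⟩
    shiftAlong (a ∷ α) (Vec.map suc (allFin N)) ((a + b) ∷ β)
      ≡⟨ shiftAlong-map-suc a α (allFin N) (a + b) β ⟩
    (a + b) ∷ shiftAlong α (allFin N) β
      ≡⟨ cong ((a + b) ∷_) (shiftAlong-allFin α β) ⟩
    (a + b) ∷ (α ⊞ β) ∎
    where open ≡-Reasoning

  wordSumℕ : ∀ {N} → ℕ → (Mono N → ℕ) → ℕ
  wordSumℕ zero    g = g 0ᵐ
  wordSumℕ (suc k) g = sumℕ (λ i → wordSumℕ k (λ α → g (unit i ⊞ α)))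

  -- H m i is (xₘ xᵢ Lᵏ)(∂) applied to the form with coefficients χ, L = x₁ + ⋯ + x_N
  IsHessian : ∀ {N} → ℕ → (Mono N → ℕ) → (Fin N → Fin N → ℕ) → Set
  IsHessian k χ H = ∀ m i → wordSumℕ k (λ γ → χ (γ ⊞ unit i ⊞ unit m)) ≡ H m i

  -- (G⁺ − G⁻) H = (d + 1) I, resp. H (G⁺ − G⁻) = (d + 1) I, kept free of subtraction
  IsScaledLeftInverse IsScaledRightInverse : ∀ {N} → ℕ → (G⁺ G⁻ H : Fin N → Fin N → ℕ) → Set
  IsScaledLeftInverse d G⁺ G⁻ H =
    ∀ l i → sumℕ (λ m → G⁺ l m ℕ.* H m i) ≡ sumℕ (λ m → G⁻ l m ℕ.* H m i) + suc d ℕ.* lookup (unit l) i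
  IsScaledRightInverse d G⁺ G⁻ H =
    ∀ m l → sumℕ (λ i → H m i ℕ.* G⁺ i l) ≡ sumℕ (λ i → H m i ℕ.* G⁻ i l) + suc d ℕ.* lookup (unit m) l

  isHessian? : ∀ {N} k χ (H : Fin N → Fin N → ℕ) → Dec (IsHessian k χ H)
  isHessian? k χ H = all²? λ _ _ → _ ℕ.≟ _

  isScaledLeftInverse? : ∀ {N} d (G⁺ G⁻ H : Fin N → Fin N → ℕ) → Dec (IsScaledLeftInverse d G⁺ G⁻ H)
  isScaledLeftInverse? d G⁺ G⁻ H = all²? λ _ _ → _ ℕ.≟ _

  isScaledRightInverse? : ∀ {N} d (G⁺ G⁻ H : Fin N → Fin N → ℕ) → Dec (IsScaledRightInverse d G⁺ G⁻ H)
  isScaledRightInverse? d G⁺ G⁻ H = all²? λ _ _ → _ ℕ.≟ _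

open Monomial

module Pairing {c ℓ} (K : CommutativeRing c ℓ) where

  open CommutativeRing K hiding (zero) renaming (_+_ to _+ᴷ_)
  open Poly K
  open import Algebra.Properties.Semiring.Mult semiring using (×-homo-+; ×-congˡ) renaming (_×_ to _·_)
  open import Algebra.Properties.Semiring.Sum semiring
    using (sum; sum-cong-≋; sum-replicate-zero; ∑-distrib-+; *-distribˡ-sum)
  open import Algebra.Properties.CommutativeSemigroup *-commutativeSemigroup using (x∙yz≈y∙xz)
  open import Relation.Binary.Reasoning.Setoid setoid

  sum-cong : ∀ {n} {f g : Fin n → Carrier} → (∀ i → f i ≈ g i) → sum f ≈ sum g
  sum-cong {n} = sum-cong-≋ {n}

  ⟪_,_⟫ : ∀ {N} → Pol N → (Mono N → Carrier) → Carrier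
  ⟪ []          , g ⟫ = 0#
  ⟪ (a , α) ∷ P , g ⟫ = a * g α +ᴷ ⟪ P , g ⟫

  ⟪⟫-cong : ∀ {N} (P : Pol N) {g h : Mono N → Carrier} → (∀ α → g α ≈ h α) → ⟪ P , g ⟫ ≈ ⟪ P , h ⟫
  ⟪⟫-cong []            g≈h = refl
  ⟪⟫-cong ((a , α) ∷ P) g≈h = +-cong (*-congˡ (g≈h α)) (⟪⟫-cong P g≈h)

  ⟪⟫-++ : ∀ {N} (P Q : Pol N) g → ⟪ P ++ Q , g ⟫ ≈ ⟪ P , g ⟫ +ᴷ ⟪ Q , g ⟫
  ⟪⟫-++ []            Q g = sym (+-identityˡ _)
  ⟪⟫-++ ((a , α) ∷ P) Q g = trans (+-congˡ (⟪⟫-++ P Q g)) (sym (+-assoc _ _ _))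

  ⟪⟫-*ˡ : ∀ {N} (P : Pol N) x h → ⟪ P , (λ γ → x * h γ) ⟫ ≈ x * ⟪ P , h ⟫
  ⟪⟫-*ˡ []            x h = sym (zeroʳ x)
  ⟪⟫-*ˡ ((a , α) ∷ P) x h = trans (+-cong (x∙yz≈y∙xz a x (h α)) (⟪⟫-*ˡ P x h)) (sym (distribˡ x _ _))

  ⟪⟫-⊗ : ∀ {N} (P Q : Pol N) g → ⟪ P ⊗ Q , g ⟫ ≈ ⟪ P , (λ γ → ⟪ Q , (λ α → g (γ ⊞ α)) ⟫) ⟫
  ⟪⟫-⊗ []            Q g = refl
  ⟪⟫-⊗ ((a , α) ∷ P) Q g = trans (⟪⟫-++ (aαQ Q) (P ⊗ Q) g) (+-cong (scaled Q) (⟪⟫-⊗ P Q g))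
    where
    aαQ : Pol _ → Pol _
    aαQ = List.map (λ { (b , β) → (a * b , α ⊞ β) })
    scaled : ∀ Q → ⟪ aαQ Q , g ⟫ ≈ a * ⟪ Q , (λ β → g (α ⊞ β)) ⟫
    scaled []            = sym (zeroʳ a)
    scaled ((b , β) ∷ Q) =
      trans (+-cong (*-assoc a b _) (scaled Q)) (sym (distribˡ a _ _))

  ⟪⟫-homog-vanish : ∀ {N} d (P : Pol N) g → Homog d P → (∀ α → deg α ≡ d → g α ≈ 0#) → ⟪ P , g ⟫ ≈ 0#
  ⟪⟫-homog-vanish d []            g _         g≈0 = refl
  ⟪⟫-homog-vanish d ((a , α) ∷ P) g (dα , hP) g≈0 =
    trans (+-cong (trans (*-congˡ (g≈0 α dα)) (zeroʳ a)) (⟪⟫-homog-vanish d P g hP g≈0)) (+-identityʳ 0#)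

  ⟪⟫-deg0 : ∀ {N} (P : Pol N) h → Homog 0 P → ⟪ P , h ⟫ ≈ ⟪ P , (λ _ → 1#) ⟫ * h 0ᵐ
  ⟪⟫-deg0 []            h _         = sym (zeroˡ _)
  ⟪⟫-deg0 ((a , α) ∷ P) h (dα , hP) rewrite deg≡0⇒0ᵐ α dα =
    trans (+-cong (*-congˡ (sym (*-identityˡ _))) (⟪⟫-deg0 P h hP))
          (trans (+-congʳ (sym (*-assoc _ _ _))) (sym (distribʳ _ _ _)))

  coeff : ∀ {N} → Pol N → Fin N → Carrier
  coeff P i = ⟪ P , (λ α → lookup α i · 1#) ⟫

  δ : ∀ {N} → Fin N → Fin N → Carrier
  δ l i = lookup (unit l) i · 1#

  sum-δ : ∀ {N} (m : Fin N) (h : Fin N → Carrier) → sum (λ i → δ m i * h i) ≈ h m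
  sum-δ {suc N} zero h = begin
    (1 · 1#) * h zero +ᴷ sum (λ i → (lookup (0ᵐ {N}) i · 1#) * h (suc i))
      ≈⟨ +-cong (trans (*-congʳ (+-identityʳ 1#)) (*-identityˡ _))
                (trans (sum-cong {N} (λ i → trans (*-congʳ (×-congˡ (Vecₚ.lookup-replicate i 0))) (zeroˡ _)))
                       (sum-replicate-zero N)) ⟩
    h zero +ᴷ 0#  ≈⟨ +-identityʳ _ ⟩
    h zero        ∎
  sum-δ {suc N} (suc m) h = trans (+-cong (zeroˡ _) (sum-δ m (λ i → h (suc i)))) (+-identityˡ _)

  ⟪⟫-deg1 : ∀ {N} (P : Pol N) h → Homog 1 P → ⟪ P , h ⟫ ≈ sum (λ i → coeff P i * h (unit i))
  ⟪⟫-deg1 {N} [] h _ = sym (trans (sum-cong {N} (λ i → zeroˡ _)) (sum-replicate-zero N))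
  ⟪⟫-deg1 {N} ((a , α) ∷ P) h (dα , hP) with deg≡1⇒unit α dα
  ... | m , ≡.refl = begin
    a * h (unit m) +ᴷ ⟪ P , h ⟫
      ≈⟨ +-cong (sym (sum-δ m (λ i → a * h (unit i)))) (⟪⟫-deg1 P h hP) ⟩
    sum (λ i → δ m i * (a * h (unit i))) +ᴷ sum (λ i → coeff P i * h (unit i))
      ≈⟨ sym (∑-distrib-+ {N} _ _) ⟩
    sum (λ i → δ m i * (a * h (unit i)) +ᴷ coeff P i * h (unit i))
      ≈⟨ sum-cong {N} (λ i → trans (+-congʳ (trans (x∙yz≈y∙xz _ a _) (sym (*-assoc a _ _))))
                                 (sym (distribʳ _ _ _))) ⟩
    sum (λ i → coeff ((a , unit m) ∷ P) i * h (unit i)) ∎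

  ⟪linear,⟫ : ∀ {N} (a : Fin N → Carrier) h → ⟪ linear a , h ⟫ ≈ sum (λ i → a i * h (unit i))
  ⟪linear,⟫ {N} a h = go (λ i → i)
    where
    go : ∀ {M} (f : Fin M → Fin N) →
         ⟪ Vec.toList (Vec.map (λ i → (a i , unit i)) (tabulate f)) , h ⟫ ≈ sum (λ j → a (f j) * h (unit (f j)))
    go {zero}  f = refl
    go {suc M} f = +-congˡ (go (λ j → f (suc j)))

  ⟪⟫-sum : ∀ {N M} (P : Pol N) (a : Fin M → Carrier) (h : Mono N → Fin M → Carrier) →
           ⟪ P , (λ γ → sum (λ i → a i * h γ i)) ⟫ ≈ sum (λ i → a i * ⟪ P , (λ γ → h γ i) ⟫)
  ⟪⟫-sum {M = M} [] a h = sym (trans (sum-cong {M} (λ i → zeroʳ _)) (sum-replicate-zero M))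
  ⟪⟫-sum {M = M} ((b , β) ∷ P) a h = begin
    b * sum (λ i → a i * h β i) +ᴷ ⟪ P , (λ γ → sum (λ i → a i * h γ i)) ⟫
      ≈⟨ +-cong (*-distribˡ-sum {M} b _) (⟪⟫-sum P a h) ⟩
    sum (λ i → b * (a i * h β i)) +ᴷ sum (λ i → a i * ⟪ P , (λ γ → h γ i) ⟫)
      ≈⟨ sym (∑-distrib-+ {M} _ _) ⟩
    sum (λ i → b * (a i * h β i) +ᴷ a i * ⟪ P , (λ γ → h γ i) ⟫)
      ≈⟨ sum-cong {M} (λ i → trans (+-congʳ (x∙yz≈y∙xz b (a i) _)) (sym (distribˡ (a i) _ _))) ⟩
    sum (λ i → a i * ⟪ (b , β) ∷ P , (λ γ → h γ i) ⟫) ∎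

  wordSum : ∀ {N} → ℕ → (Mono N → Carrier) → Carrier
  wordSum zero    g = g 0ᵐ
  wordSum (suc k) g = sum (λ i → wordSum k (λ α → g (unit i ⊞ α)))

  wordSum-cong : ∀ {N} k {g h : Mono N → Carrier} → (∀ α → g α ≈ h α) → wordSum k g ≈ wordSum k h
  wordSum-cong zero    g≈h = g≈h _
  wordSum-cong {N} (suc k) g≈h = sum-cong {N} (λ i → wordSum-cong k (λ α → g≈h _))

  sum-· : ∀ {N} (f : Fin N → ℕ) → sum (λ i → f i · 1#) ≈ sumℕ f · 1#
  sum-· {zero}  f = refl
  sum-· {suc N} f = trans (+-congˡ (sum-· (λ i → f (suc i)))) (sym (×-homo-+ 1# (f zero) _))

  wordSum-· : ∀ {N} k (g : Mono N → ℕ) → wordSum k (λ α → g α · 1#) ≈ wordSumℕ k g · 1#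
  wordSum-· zero    g = refl
  wordSum-· {N} (suc k) g =
    trans (sum-cong {N} (λ i → wordSum-· k (λ α → g (unit i ⊞ α)))) (sum-· (λ i → wordSumℕ k (λ α → g (unit i ⊞ α))))

  ⟪sumVars^,⟫ : ∀ {N} k (g : Mono N → Carrier) → ⟪ sumVars ^' k , g ⟫ ≈ wordSum k g
  ⟪sumVars^,⟫ zero    g = trans (+-identityʳ _) (*-identityˡ _)
  ⟪sumVars^,⟫ {N} (suc k) g = begin
    ⟪ sumVars ⊗ (sumVars ^' k) , g ⟫
      ≈⟨ ⟪⟫-⊗ sumVars (sumVars ^' k) g ⟩
    ⟪ sumVars , (λ γ → ⟪ sumVars ^' k , (λ α → g (γ ⊞ α)) ⟫) ⟫
      ≈⟨ ⟪linear,⟫ {N} (λ _ → 1#) (λ γ → ⟪ sumVars ^' k , (λ α → g (γ ⊞ α)) ⟫) ⟩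
    sum (λ i → 1# * ⟪ sumVars ^' k , (λ α → g (unit i ⊞ α)) ⟫)
      ≈⟨ sum-cong {N} (λ i → trans (*-identityˡ _) (⟪sumVars^,⟫ k (λ α → g (unit i ⊞ α)))) ⟩
    wordSum (suc k) g ∎

  Homog-++ : ∀ {N} d (P Q : Pol N) → Homog d P → Homog d Q → Homog d (P ++ Q)
  Homog-++ d []            Q _         hQ = hQ
  Homog-++ d ((a , α) ∷ P) Q (dα , hP) hQ = dα , Homog-++ d P Q hP hQ

  Homog-⊗ : ∀ {N} d e (P Q : Pol N) → Homog d P → Homog e Q → Homog (d + e) (P ⊗ Q)
  Homog-⊗ d e []            Q _         hQ = tt
  Homog-⊗ d e ((a , α) ∷ P) Q (dα , hP) hQ = Homog-++ (d + e) _ (P ⊗ Q) (shifted Q hQ) (Homog-⊗ d e P Q hP hQ)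
    where
    shifted : ∀ Q → Homog e Q → Homog (d + e) (List.map (λ { (b , β) → (a * b , α ⊞ β) }) Q)
    shifted []            _         = tt
    shifted ((b , β) ∷ Q) (dβ , hQ) = ≡.trans (deg-⊞ α β) (≡.cong₂ _+_ dα dβ) , shifted Q hQ

  Homog-linear : ∀ {N} (a : Fin N → Carrier) → Homog 1 (linear a)
  Homog-linear {N} a = go (allFin N)
    where
    go : ∀ {m} (is : Vec (Fin N) m) → Homog 1 (Vec.toList (Vec.map (λ i → (a i , unit i)) is))
    go []       = tt
    go (i ∷ is) = deg-unit i , go is

  Homog-^' : ∀ {N} (L : Pol N) → Homog 1 L → ∀ k → Homog k (L ^' k)
  Homog-^' {N} L hL zero    = deg-0ᵐ {N} , tt
  Homog-^' {N} L hL (suc k) = Homog-⊗ 1 k L (L ^' k) hL (Homog-^' L hL k)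

module Apolarity {c ℓ} (K : CommutativeRing c ℓ) where

  open CommutativeRing K hiding (zero) renaming (_+_ to _+ᴷ_)
  open Poly K
  open Pairing K
  open import Algebra.Properties.Semiring.Mult semiring
    using (×-homo-+; ×1-homo-*; ×-congˡ) renaming (_×_ to _·_)
  open import Algebra.Properties.Semiring.Sum semiring
    using (sum; sum-replicate-zero; ∑-distrib-+; ∑-comm; *-distribˡ-sum; *-distribʳ-sum)
  open import Algebra.Properties.Ring ring using (-‿distribˡ-*; x[y-z]≈xy-xz; [y-z]x≈yx-zx)
  open import Algebra.Properties.AbelianGroup +-abelianGroup using (⁻¹-∙-comm; ε⁻¹≈ε; xyx⁻¹≈y)
  open import Algebra.Properties.CommutativeSemigroup *-commutativeSemigroup using (x∙yz≈y∙xz)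
  open import Relation.Binary.Reasoning.Setoid setoid

  SquarefreeSupported : ∀ {N} → Coeffs N → Set ℓ
  SquarefreeSupported f = ∀ γ i → 2 ≤ lookup γ i → f γ ≈ 0#

  -- On a squarefree-supported f the factor (βᵢ + 1) of ∂ᵢ is 1 wherever the value is nonzero.
  iter-∂ : ∀ {N} (f : Coeffs N) → SquarefreeSupported f → ∀ k i β → iter k (∂ i) f β ≈ f (shiftAt β i k)
  iter-∂ f f-sqf zero    i β = refl
  iter-∂ f f-sqf (suc k) i β =
    trans (*-congˡ (iter-∂ f f-sqf k i (updateAt β i suc))) (unit-factor (lookup β i) ≡.refl)
    where
    unit-factor : ∀ b → lookup β i ≡ b → (suc b · 1#) * f (shiftAt (updateAt β i suc) i k) ≈ f (shiftAt (updateAt β i suc) i k)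
    unit-factor zero    _   = trans (*-congʳ (+-identityʳ 1#)) (*-identityˡ _)
    unit-factor (suc b) βᵢ≡ = trans (*-congˡ vanishes) (trans (zeroʳ _) (sym vanishes))
      where
      vanishes : f (shiftAt (updateAt β i suc) i k) ≈ 0#
      vanishes = f-sqf _ i (ℕₚ.≤-trans 2≤βᵢ+1 (lookup-shiftAt k (updateAt β i suc) i i))
        where
        2≤βᵢ+1 : 2 ≤ lookup (updateAt β i suc) i
        2≤βᵢ+1 rewrite Vecₚ.lookup∘updateAt i {suc} β | βᵢ≡ = s≤s (s≤s z≤n)

  iter-cong : ∀ {N} {f g : Coeffs N} → (∀ β → f β ≈ g β) → ∀ k i β → iter k (∂ i) f β ≈ iter k (∂ i) g β
  iter-cong f≈g zero    i β = f≈g β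
  iter-cong f≈g (suc k) i β = *-congˡ (iter-cong f≈g k i (updateAt β i suc))

  ∂^-shift : ∀ {N} (f : Coeffs N) → SquarefreeSupported f → ∀ α β → ∂^ α f β ≈ f (α ⊞ β)
  ∂^-shift {N} f f-sqf α β = trans (along (allFin N) β) (reflexive (≡.cong f (shiftAlong-allFin α β)))
    where
    along : ∀ {m} (is : Vec (Fin N) m) β →
            Vec.foldr _ (λ i g → iter (lookup α i) (∂ i) g) f is β ≈ f (shiftAlong α is β)
    along []       β = refl
    along (i ∷ is) β = trans (iter-cong (along is) (lookup α i) i β)
      (iter-∂ (λ γ → f (shiftAlong α is γ))
              (λ γ j 2≤ → f-sqf _ j (ℕₚ.≤-trans 2≤ (lookup-shiftAlong α is γ j))) (lookup α i) i β)

  act≈⟪⟫ : ∀ {N} (f : Coeffs N) → SquarefreeSupported f → ∀ P β → act P f β ≈ ⟪ P , (λ α → f (α ⊞ β)) ⟫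
  act≈⟪⟫ f f-sqf []            β = refl
  act≈⟪⟫ f f-sqf ((a , α) ∷ P) β = +-cong (*-congˡ (∂^-shift f f-sqf α β)) (act≈⟪⟫ f f-sqf P β)

  act-⊕ : ∀ {N} (P Q : Pol N) f β → act (P ⊕ Q) f β ≈ act P f β +ᴷ act Q f β
  act-⊕ []            Q f β = sym (+-identityˡ _)
  act-⊕ ((a , α) ∷ P) Q f β = trans (+-congˡ (act-⊕ P Q f β)) (sym (+-assoc _ _ _))

  act-⊝ : ∀ {N} (P : Pol N) f β → act (⊝ P) f β ≈ - act P f β
  act-⊝ []            f β = sym ε⁻¹≈ε
  act-⊝ ((a , α) ∷ P) f β = trans (+-cong (sym (-‿distribˡ-* a _)) (act-⊝ P f β)) (⁻¹-∙-comm _ _)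

  act-⊕⊝ : ∀ {N} (P Q : Pol N) f β → act P f β ≈ act Q f β → act (P ⊕ (⊝ Q)) f β ≈ 0#
  act-⊕⊝ P Q f β eq = begin
    act (P ⊕ (⊝ Q)) f β        ≈⟨ act-⊕ P (⊝ Q) f β ⟩
    act P f β +ᴷ act (⊝ Q) f β ≈⟨ +-cong eq (act-⊝ Q f β) ⟩
    act Q f β +ᴷ - act Q f β   ≈⟨ -‿inverseʳ _ ⟩
    0#                         ∎

  sum-neg : ∀ {n} (f : Fin n → Carrier) → sum (λ i → - f i) ≈ - sum f
  sum-neg {zero}  f = sym ε⁻¹≈ε
  sum-neg {suc n} f = trans (+-congˡ (sum-neg (λ i → f (suc i)))) (⁻¹-∙-comm _ _)

  sum-·-difference : ∀ {n} (f g : Fin n → ℕ) z → sumℕ f ≡ sumℕ g + z →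
                     sum (λ i → f i · 1# +ᴷ - (g i · 1#)) ≈ z · 1#
  sum-·-difference {n} f g z eq = begin
    sum (λ i → f i · 1# +ᴷ - (g i · 1#))          ≈⟨ ∑-distrib-+ {n} _ _ ⟩
    sum (λ i → f i · 1#) +ᴷ sum (λ i → - (g i · 1#)) ≈⟨ +-cong (sum-· f) (sum-neg {n} _) ⟩
    sumℕ f · 1# +ᴷ - sum (λ i → g i · 1#)          ≈⟨ +-cong (×-congˡ eq) (-‿cong (sum-· g)) ⟩
    (sumℕ g + z) · 1# +ᴷ - (sumℕ g · 1#)           ≈⟨ +-congʳ (×-homo-+ 1# (sumℕ g) z) ⟩
    sumℕ g · 1# +ᴷ z · 1# +ᴷ - (sumℕ g · 1#)       ≈⟨ xyx⁻¹≈y _ _ ⟩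
    z · 1#                                         ∎

  module _ {n} (G H : Fin n → Fin n → Carrier) (s t : Carrier) (ts≈1 : t * s ≈ 1#)
           (HG≈sI : ∀ m l → sum (λ i → H m i * G i l) ≈ s * δ m l) where

    right-inverse-solves : ∀ (q : Fin n → Carrier) m → sum (λ i → H m i * (t * sum (λ l → G i l * q l))) ≈ q m
    right-inverse-solves q m = begin
      sum (λ i → H m i * (t * sum (λ l → G i l * q l)))   ≈⟨ sum-cong {n} (λ i → x∙yz≈y∙xz _ t _) ⟩
      sum (λ i → t * (H m i * sum (λ l → G i l * q l)))   ≈⟨ sym (*-distribˡ-sum {n} t _) ⟩
      t * sum (λ i → H m i * sum (λ l → G i l * q l))     ≈⟨ *-congˡ (sum-cong {n} (λ i → *-distribˡ-sum {n} _ _)) ⟩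
      t * sum (λ i → sum (λ l → H m i * (G i l * q l)))   ≈⟨ *-congˡ (∑-comm {n} {n} _) ⟩
      t * sum (λ l → sum (λ i → H m i * (G i l * q l)))   ≈⟨ *-congˡ (sum-cong {n} (λ l → trans (sum-cong {n} (λ i → sym (*-assoc _ _ _))) (sym (*-distribʳ-sum {n} _ _)))) ⟩
      t * sum (λ l → sum (λ i → H m i * G i l) * q l)     ≈⟨ *-congˡ (sum-cong {n} (λ l → trans (*-congʳ (HG≈sI m l)) (*-assoc _ _ _))) ⟩
      t * sum (λ l → s * (δ m l * q l))                   ≈⟨ *-congˡ (sym (*-distribˡ-sum {n} s _)) ⟩
      t * (s * sum (λ l → δ m l * q l))                   ≈⟨ sym (*-assoc t s _) ⟩
      t * s * sum (λ l → δ m l * q l)                     ≈⟨ *-cong ts≈1 (sum-δ m q) ⟩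
      1# * q m                                            ≈⟨ *-identityˡ _ ⟩
      q m                                                 ∎

  module _ (isField : IsField) where

    x*y≈0⇒x≈0 : ∀ {x y} → ¬ (y ≈ 0#) → x * y ≈ 0# → x ≈ 0#
    x*y≈0⇒x≈0 {x} {y} y≉0 xy≈0 with proj₂ isField y y≉0
    ... | z , yz≈1 = begin
      x           ≈⟨ sym (*-identityʳ x) ⟩
      x * 1#      ≈⟨ *-congˡ (sym yz≈1) ⟩
      x * (y * z) ≈⟨ sym (*-assoc x y z) ⟩
      x * y * z   ≈⟨ *-congʳ xy≈0 ⟩
      0# * z      ≈⟨ zeroˡ z ⟩
      0#          ∎

    module _ {n} (G H : Fin n → Fin n → Carrier) (s : Carrier) (s≉0 : ¬ (s ≈ 0#))
             (GH≈sI : ∀ l i → sum (λ m → G l m * H m i) ≈ s * δ l i) where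

      left-inverse-injective : (c : Fin n → Carrier) → (∀ m → sum (λ i → H m i * c i) ≈ 0#) →
                               ∀ l → c l ≈ 0#
      left-inverse-injective c Hc≈0 l = x*y≈0⇒x≈0 s≉0 (trans (*-comm _ _) (begin
        s * c l                                        ≈⟨ *-congˡ (sym (sum-δ l c)) ⟩
        s * sum (λ i → δ l i * c i)                    ≈⟨ *-distribˡ-sum {n} s _ ⟩
        sum (λ i → s * (δ l i * c i))                  ≈⟨ sum-cong {n} (λ i → trans (sym (*-assoc _ _ _)) (*-congʳ (sym (GH≈sI l i)))) ⟩
        sum (λ i → sum (λ m → G l m * H m i) * c i)    ≈⟨ sum-cong {n} (λ i → *-distribʳ-sum {n} (c i) _) ⟩
        sum (λ i → sum (λ m → G l m * H m i * c i))    ≈⟨ ∑-comm {n} {n} _ ⟩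
        sum (λ m → sum (λ i → G l m * H m i * c i))    ≈⟨ sum-cong {n} (λ m → trans (sum-cong {n} (λ i → *-assoc _ _ _)) (sym (*-distribˡ-sum {n} _ _))) ⟩
        sum (λ m → G l m * sum (λ i → H m i * c i))    ≈⟨ sum-cong {n} (λ m → trans (*-congˡ (Hc≈0 m)) (zeroʳ _)) ⟩
        sum {n} (λ _ → 0#)                             ≈⟨ sum-replicate-zero n ⟩
        0#                                             ∎))

  module SquarefreeForm (isField : IsField) (charZero : CharZero) {N} (r : ℕ) (Φ : Coeffs N) (χ : Mono N → ℕ)
              (Φ≈χ : ∀ γ → Φ γ ≈ χ γ · 1#)
              (χ-squarefree : ∀ γ i → 2 ≤ lookup γ i → χ γ ≡ 0)
              (χ-homogeneous : ∀ γ → deg γ ≢ r → χ γ ≡ 0) where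

    L : Pol N
    L = sumVars

    χ≡0⇒Φ≈0 : ∀ {γ} → χ γ ≡ 0 → Φ γ ≈ 0#
    χ≡0⇒Φ≈0 {γ} χγ≡0 = trans (Φ≈χ γ) (×-congˡ χγ≡0)

    Φ-squarefree : SquarefreeSupported Φ
    Φ-squarefree γ i 2≤ = χ≡0⇒Φ≈0 (χ-squarefree γ i 2≤)

    act-vanish : ∀ d (P : Pol N) β → Homog d P → d + deg β ≢ r → act P Φ β ≈ 0#
    act-vanish d P β hP d+β≢r = trans (act≈⟪⟫ Φ Φ-squarefree P β) (⟪⟫-homog-vanish d P _ hP (λ α degα≡d →
      χ≡0⇒Φ≈0 (χ-homogeneous (α ⊞ β) (λ eq → d+β≢r
        (≡.trans (≡.cong (_+ deg β) (≡.sym degα≡d)) (≡.trans (≡.sym (deg-⊞ α β)) eq))))))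

    annihilates-difference : ∀ e (P Q : Pol N) → Homog e P → Homog e Q →
      (∀ β → e + deg β ≡ r → act P Φ β ≈ act Q Φ β) → Ann Φ (P ⊕ (⊝ Q))
    annihilates-difference e P Q hP hQ agree β with e + deg β ℕ.≟ r
    ... | yes e+β≡r = act-⊕⊝ P Q Φ β (agree β e+β≡r)
    ... | no  e+β≢r = act-⊕⊝ P Q Φ β (trans (act-vanish e P β hP e+β≢r) (sym (act-vanish e Q β hQ e+β≢r)))

    isTopDegree : ∀ γ₀ c → χ γ₀ ≡ suc c → IsTopDegree Φ r
    isTopDegree γ₀ c χγ₀≡ = (P₀ , (degγ₀ , tt) , P₀∉Ann) , above-r
      where
      P₀ : Pol N
      P₀ = (1# , γ₀) ∷ []
      degγ₀ : deg γ₀ ≡ r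
      degγ₀ with deg γ₀ ℕ.≟ r
      ... | yes eq = eq
      ... | no  ne with () ← ≡.trans (≡.sym χγ₀≡) (χ-homogeneous γ₀ ne)
      P₀∉Ann : ¬ Ann Φ P₀
      P₀∉Ann ann = charZero c (begin
        suc c · 1#               ≈⟨ ×-congˡ χγ₀≡ ⟨
        χ γ₀ · 1#                ≈⟨ Φ≈χ γ₀ ⟨
        Φ γ₀                     ≈⟨ reflexive (≡.cong Φ (⊞-identityʳ γ₀)) ⟨
        Φ (γ₀ ⊞ 0ᵐ)              ≈⟨ trans (+-identityʳ _) (*-identityˡ _) ⟨
        ⟪ P₀ , (λ α → Φ (α ⊞ 0ᵐ)) ⟫ ≈⟨ act≈⟪⟫ Φ Φ-squarefree P₀ 0ᵐ ⟨
        act P₀ Φ 0ᵐ              ≈⟨ ann 0ᵐ ⟩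
        0#                       ∎)
      above-r : ∀ j → r < j → ∀ P → Homog j P → Ann Φ P
      above-r j r<j P hP β = act-vanish j P β hP (λ eq →
        ℕₚ.<-irrefl ≡.refl (ℕₚ.<-≤-trans r<j (ℕₚ.≤-trans (ℕₚ.m≤m+n j (deg β)) (ℕₚ.≤-reflexive eq))))

    act-one⊗ : ∀ (P : Pol N) β → act (one ⊗ P) Φ β ≈ act P Φ β
    act-one⊗ P β = begin
      act (one ⊗ P) Φ β                               ≈⟨ act≈⟪⟫ Φ Φ-squarefree (one ⊗ P) β ⟩
      ⟪ one ⊗ P , (λ α → Φ (α ⊞ β)) ⟫                 ≈⟨ ⟪⟫-⊗ one P _ ⟩
      1# * ⟪ P , (λ α → Φ (0ᵐ ⊞ α ⊞ β)) ⟫ +ᴷ 0#       ≈⟨ trans (+-identityʳ _) (*-identityˡ _) ⟩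
      ⟪ P , (λ α → Φ (0ᵐ ⊞ α ⊞ β)) ⟫                  ≈⟨ ⟪⟫-cong P (λ α → reflexive (≡.cong (λ γ → Φ (γ ⊞ β)) (⊞-identityˡ α))) ⟩
      ⟪ P , (λ α → Φ (α ⊞ β)) ⟫                       ≈⟨ act≈⟪⟫ Φ Φ-squarefree P β ⟨
      act P Φ β                                       ∎

    mulBijective-L⁰ : ∀ j → MulBijective Φ L 0 j
    mulBijective-L⁰ j =
        (λ P _ ann β → trans (sym (act-one⊗ P β)) (ann β))
      , (λ Q hQ → Q , ≡.subst (λ d → Homog d Q) (ℕₚ.+-identityʳ j) hQ
                    , λ β → act-⊕⊝ Q (one ⊗ Q) Φ β (sym (act-one⊗ Q β)))

    wordSum-Φ : ∀ k (g : Mono N → Mono N) → wordSum k (λ γ → Φ (g γ)) ≈ wordSumℕ k (λ γ → χ (g γ)) · 1#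
    wordSum-Φ k g = trans (wordSum-cong {N} k (λ γ → Φ≈χ (g γ))) (wordSum-· k (λ γ → χ (g γ)))

    inverse : ∀ d → ∃[ t ] t * (suc d · 1#) ≈ 1#
    inverse d with proj₂ isField (suc d · 1#) (charZero d)
    ... | t , st≈1 = t , trans (*-comm t _) st≈1

    module _ (h : ℕ) (count : wordSumℕ r χ ≡ suc h) where

      act-deg0 : ∀ (P : Pol N) β → Homog 0 P → act P Φ β ≈ ⟪ P , (λ _ → 1#) ⟫ * Φ β
      act-deg0 P β hP = begin
        act P Φ β                                 ≈⟨ act≈⟪⟫ Φ Φ-squarefree P β ⟩
        ⟪ P , (λ α → Φ (α ⊞ β)) ⟫                 ≈⟨ ⟪⟫-deg0 P _ hP ⟩
        ⟪ P , (λ _ → 1#) ⟫ * Φ (0ᵐ ⊞ β)           ≈⟨ *-congˡ (reflexive (≡.cong Φ (⊞-identityˡ β))) ⟩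
        ⟪ P , (λ _ → 1#) ⟫ * Φ β                  ∎

      act-L^r-deg0 : ∀ (P : Pol N) → Homog 0 P → act ((L ^' r) ⊗ P) Φ 0ᵐ ≈ ⟪ P , (λ _ → 1#) ⟫ * (suc h · 1#)
      act-L^r-deg0 P hP = begin
        act ((L ^' r) ⊗ P) Φ 0ᵐ                                  ≈⟨ act≈⟪⟫ Φ Φ-squarefree ((L ^' r) ⊗ P) 0ᵐ ⟩
        ⟪ (L ^' r) ⊗ P , (λ α → Φ (α ⊞ 0ᵐ)) ⟫                    ≈⟨ ⟪⟫-⊗ (L ^' r) P _ ⟩
        ⟪ L ^' r , (λ γ → ⟪ P , (λ α → Φ (γ ⊞ α ⊞ 0ᵐ)) ⟫) ⟫      ≈⟨ ⟪⟫-cong (L ^' r) (λ γ → ⟪⟫-deg0 P _ hP) ⟩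
        ⟪ L ^' r , (λ γ → c₀ * Φ (γ ⊞ 0ᵐ ⊞ 0ᵐ)) ⟫                ≈⟨ ⟪⟫-*ˡ (L ^' r) c₀ _ ⟩
        c₀ * ⟪ L ^' r , (λ γ → Φ (γ ⊞ 0ᵐ ⊞ 0ᵐ)) ⟫                ≈⟨ *-congˡ (⟪sumVars^,⟫ r _) ⟩
        c₀ * wordSum r (λ γ → Φ (γ ⊞ 0ᵐ ⊞ 0ᵐ))                   ≈⟨ *-congˡ (wordSum-cong {N} r (λ γ → reflexive (≡.cong Φ (⊞0ᵐ⊞0ᵐ γ)))) ⟩
        c₀ * wordSum r Φ                                         ≈⟨ *-congˡ (wordSum-Φ r (λ γ → γ)) ⟩
        c₀ * (wordSumℕ r χ · 1#)                                 ≈⟨ *-congˡ (×-congˡ count) ⟩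
        c₀ * (suc h · 1#)                                        ∎
        where
        c₀ = ⟪ P , (λ _ → 1#) ⟫
        ⊞0ᵐ⊞0ᵐ : ∀ γ → γ ⊞ 0ᵐ ⊞ 0ᵐ ≡ γ
        ⊞0ᵐ⊞0ᵐ γ = ≡.trans (⊞-identityʳ (γ ⊞ 0ᵐ)) (⊞-identityʳ γ)

      mulBijective-degree0 : MulBijective Φ L r 0
      mulBijective-degree0 = injective , surjective
        where
        injective : ∀ P → Homog 0 P → Ann Φ ((L ^' r) ⊗ P) → Ann Φ P
        injective P hP ann β = begin
          act P Φ β                     ≈⟨ act-deg0 P β hP ⟩
          ⟪ P , (λ _ → 1#) ⟫ * Φ β      ≈⟨ *-congʳ c₀≈0 ⟩
          0# * Φ β                      ≈⟨ zeroˡ _ ⟩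
          0#                            ∎
          where
          c₀≈0 : ⟪ P , (λ _ → 1#) ⟫ ≈ 0#
          c₀≈0 = x*y≈0⇒x≈0 isField (charZero h) (trans (sym (act-L^r-deg0 P hP)) (ann 0ᵐ))

        surjective : ∀ Q → Homog (0 + r) Q → ∃[ P ] (Homog 0 P × Ann Φ (Q ⊕ (⊝ ((L ^' r) ⊗ P))))
        surjective Q hQ = P , hP , annihilates-difference r Q ((L ^' r) ⊗ P) hQ hL^rP agree
          where
          t = proj₁ (inverse h)
          q = act Q Φ 0ᵐ
          P : Pol N
          P = (q * t , 0ᵐ) ∷ []
          hP : Homog 0 P
          hP = deg-0ᵐ {N} , tt
          hL^rP : Homog r ((L ^' r) ⊗ P)
          hL^rP = ≡.subst (λ d → Homog d ((L ^' r) ⊗ P)) (ℕₚ.+-identityʳ r)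
                          (Homog-⊗ r 0 (L ^' r) P (Homog-^' L (Homog-linear (λ _ → 1#)) r) hP)
          agree : ∀ β → r + deg β ≡ r → act Q Φ β ≈ act ((L ^' r) ⊗ P) Φ β
          agree β r+β≡r with deg≡0⇒0ᵐ β (ℕₚ.+-cancelˡ-≡ r (deg β) 0 (≡.trans r+β≡r (≡.sym (ℕₚ.+-identityʳ r))))
          ... | ≡.refl = sym (begin
            act ((L ^' r) ⊗ P) Φ 0ᵐ       ≈⟨ act-L^r-deg0 P hP ⟩
            (q * t * 1# +ᴷ 0#) * (suc h · 1#) ≈⟨ *-congʳ (trans (+-identityʳ _) (*-identityʳ _)) ⟩
            q * t * (suc h · 1#)          ≈⟨ *-assoc q t _ ⟩
            q * (t * (suc h · 1#))        ≈⟨ *-congˡ (proj₂ (inverse h)) ⟩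
            q * 1#                        ≈⟨ *-identityʳ q ⟩
            q                             ∎)

    module _ (k : ℕ) (r≡2+k : r ≡ 2 + k) (H Gp Gm : Fin N → Fin N → ℕ) (d : ℕ) (H-def : IsHessian k χ H)
             (GH : IsScaledLeftInverse d Gp Gm H) (HG : IsScaledRightInverse d Gp Gm H) where

      Hᴷ Gᴷ : Fin N → Fin N → Carrier
      Hᴷ m i = H m i · 1#
      Gᴷ l m = Gp l m · 1# +ᴷ - (Gm l m · 1#)

      s : Carrier
      s = suc d · 1#

      GᴷHᴷ≈sI : ∀ l i → sum (λ m → Gᴷ l m * Hᴷ m i) ≈ s * δ l i
      GᴷHᴷ≈sI l i = begin
        sum (λ m → Gᴷ l m * Hᴷ m i)
          ≈⟨ sum-cong {N} (λ m → trans ([y-z]x≈yx-zx _ _ _)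
                (+-cong (sym (×1-homo-* (Gp l m) (H m i))) (-‿cong (sym (×1-homo-* (Gm l m) (H m i)))))) ⟩
        sum (λ m → (Gp l m ℕ.* H m i) · 1# +ᴷ - ((Gm l m ℕ.* H m i) · 1#))
          ≈⟨ sum-·-difference {N} (λ m → Gp l m ℕ.* H m i) (λ m → Gm l m ℕ.* H m i) _ (GH l i) ⟩
        (suc d ℕ.* lookup (unit l) i) · 1#
          ≈⟨ ×1-homo-* (suc d) (lookup (unit l) i) ⟩
        s * δ l i ∎

      HᴷGᴷ≈sI : ∀ m l → sum (λ i → Hᴷ m i * Gᴷ i l) ≈ s * δ m l
      HᴷGᴷ≈sI m l = begin
        sum (λ i → Hᴷ m i * Gᴷ i l)
          ≈⟨ sum-cong {N} (λ i → trans (x[y-z]≈xy-xz _ _ _)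
                (+-cong (sym (×1-homo-* (H m i) (Gp i l))) (-‿cong (sym (×1-homo-* (H m i) (Gm i l)))))) ⟩
        sum (λ i → (H m i ℕ.* Gp i l) · 1# +ᴷ - ((H m i ℕ.* Gm i l) · 1#))
          ≈⟨ sum-·-difference {N} (λ i → H m i ℕ.* Gp i l) (λ i → H m i ℕ.* Gm i l) _ (HG m l) ⟩
        (suc d ℕ.* lookup (unit m) l) · 1#
          ≈⟨ ×1-homo-* (suc d) (lookup (unit m) l) ⟩
        s * δ m l ∎

      act-L^k-deg1 : ∀ (P : Pol N) (a : Fin N → Carrier) → (∀ g → ⟪ P , g ⟫ ≈ sum (λ i → a i * g (unit i))) →
                     ∀ m → act ((L ^' k) ⊗ P) Φ (unit m) ≈ sum (λ i → Hᴷ m i * a i)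
      act-L^k-deg1 P a P≈a m = begin
        act ((L ^' k) ⊗ P) Φ (unit m)
          ≈⟨ act≈⟪⟫ Φ Φ-squarefree ((L ^' k) ⊗ P) (unit m) ⟩
        ⟪ (L ^' k) ⊗ P , (λ α → Φ (α ⊞ unit m)) ⟫
          ≈⟨ ⟪⟫-⊗ (L ^' k) P _ ⟩
        ⟪ L ^' k , (λ γ → ⟪ P , (λ α → Φ (γ ⊞ α ⊞ unit m)) ⟫) ⟫
          ≈⟨ ⟪⟫-cong (L ^' k) (λ γ → P≈a _) ⟩
        ⟪ L ^' k , (λ γ → sum (λ i → a i * Φ (γ ⊞ unit i ⊞ unit m))) ⟫
          ≈⟨ ⟪⟫-sum (L ^' k) a _ ⟩
        sum (λ i → a i * ⟪ L ^' k , (λ γ → Φ (γ ⊞ unit i ⊞ unit m)) ⟫)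
          ≈⟨ sum-cong {N} (λ i → *-congˡ (trans (⟪sumVars^,⟫ k _) (trans (wordSum-Φ k _) (×-congˡ (H-def m i))))) ⟩
        sum (λ i → a i * Hᴷ m i)
          ≈⟨ sum-cong {N} (λ i → *-comm _ _) ⟩
        sum (λ i → Hᴷ m i * a i) ∎

      mulBijective-degree1 : MulBijective Φ L k 1
      mulBijective-degree1 = injective , surjective
        where
        injective : ∀ P → Homog 1 P → Ann Φ ((L ^' k) ⊗ P) → Ann Φ P
        injective P hP ann β = begin
          act P Φ β                                  ≈⟨ act≈⟪⟫ Φ Φ-squarefree P β ⟩
          ⟪ P , (λ α → Φ (α ⊞ β)) ⟫                  ≈⟨ ⟪⟫-deg1 P _ hP ⟩
          sum (λ i → coeff P i * Φ (unit i ⊞ β))     ≈⟨ sum-cong {N} (λ i → trans (*-congʳ (coeff≈0 i)) (zeroˡ _)) ⟩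
          sum {N} (λ _ → 0#)                         ≈⟨ sum-replicate-zero N ⟩
          0#                                         ∎
          where
          coeff≈0 : ∀ i → coeff P i ≈ 0#
          coeff≈0 = left-inverse-injective isField Gᴷ Hᴷ s (charZero d) GᴷHᴷ≈sI (coeff P)
                      (λ m → trans (sym (act-L^k-deg1 P (coeff P) (λ g → ⟪⟫-deg1 P g hP) m)) (ann (unit m)))

        surjective : ∀ Q → Homog (1 + k) Q → ∃[ P ] (Homog 1 P × Ann Φ (Q ⊕ (⊝ ((L ^' k) ⊗ P))))
        surjective Q hQ = P , Homog-linear a , annihilates-difference (1 + k) Q ((L ^' k) ⊗ P) hQ hL^kP agree
          where
          t = proj₁ (inverse d)
          q : Fin N → Carrier
          q m = act Q Φ (unit m)
          a : Fin N → Carrier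
          a i = t * sum (λ l → Gᴷ i l * q l)
          P : Pol N
          P = linear a
          hL^kP : Homog (1 + k) ((L ^' k) ⊗ P)
          hL^kP = ≡.subst (λ e → Homog e ((L ^' k) ⊗ P)) (ℕₚ.+-comm k 1)
                          (Homog-⊗ k 1 (L ^' k) P (Homog-^' L (Homog-linear (λ _ → 1#)) k) (Homog-linear a))
          agree : ∀ β → 1 + k + deg β ≡ r → act Q Φ β ≈ act ((L ^' k) ⊗ P) Φ β
          agree β eq with deg≡1⇒unit β (ℕₚ.+-cancelˡ-≡ (1 + k) (deg β) 1
                            (≡.trans eq (≡.trans r≡2+k (≡.cong suc (ℕₚ.+-comm 1 k)))))
          ... | m , ≡.refl = sym (trans (act-L^k-deg1 P a (⟪linear,⟫ a) m)
                                        (right-inverse-solves Gᴷ Hᴷ s t (proj₂ (inverse d)) HᴷGᴷ≈sI q m))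

open ≡ using (refl)

CycleCandidate : ℕ → Set
CycleCandidate n = Σ ℕ λ m → Vec (Fin n) (3 + m)

module Forests (n : ℕ) (S : Subset (#E n)) where

  Adj? : ∀ a b → Dec (Adj n S a b)
  Adj? a b = Fin.any? λ e → ((edgeEnds n e ≟² (a , b)) ⊎-dec (edgeEnds n e ≟² (b , a))) ×-dec (lookup S e Bool.≟ true)
    where _≟²_ = Product.≡-dec Fin._≟_ Fin._≟_

  Adj-sym : ∀ {a b} → Adj n S a b → Adj n S b a
  Adj-sym (e , inj₁ ends , e∈S) = e , inj₂ ends , e∈S
  Adj-sym (e , inj₂ ends , e∈S) = e , inj₁ ends , e∈S

  suc-suc≢inject₁-inject₁ : ∀ {k} (i : Fin k) → Fin.suc (suc i) ≢ inject₁ (inject₁ i)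
  suc-suc≢inject₁-inject₁ (suc i) eq = suc-suc≢inject₁-inject₁ i (Fin.suc-injective eq)

  module _ (C : Cycle n S) where
    open Cycle C

    two-neighbours : ∀ p → ∃[ p₁ ] ∃[ p₂ ] (p₁ ≢ p₂ × Adj n S (v p) (v p₁) × Adj n S (v p) (v p₂))
    two-neighbours zero    = suc zero , fromℕ (suc (suc m)) , (λ ()) , steps zero , Adj-sym close
    two-neighbours (suc p) with view p
    ... | ‵fromℕ     = zero , inject₁ (fromℕ (suc m)) , (λ ()) , close , Adj-sym (steps (fromℕ (suc m)))
    ... | ‵inject₁ i = suc (suc i) , inject₁ (inject₁ i) , suc-suc≢inject₁-inject₁ i
                     , steps (suc i) , Adj-sym (steps (inject₁ i))

  record CycleWithin (U : Fin n → Bool) : Set where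
    field
      cycle  : Cycle n S
      within : ∀ p → U (Cycle.v cycle p) ≡ true

  IsLeaf : (Fin n → Bool) → Fin n → Set
  IsLeaf U a = ∀ b c → U b ≡ true → U c ≡ true → Adj n S a b → Adj n S a c → b ≡ c

  IsLeaf? : ∀ U a → Dec (IsLeaf U a)
  IsLeaf? U a = Fin.all? λ b → Fin.all? λ c →
    (U b Bool.≟ true) →-dec (U c Bool.≟ true) →-dec Adj? a b →-dec Adj? a c →-dec b Fin.≟ c

  leaf-off-cycle : ∀ {U a} → IsLeaf U a → (C : CycleWithin U) → ∀ p → Cycle.v (CycleWithin.cycle C) p ≢ a
  leaf-off-cycle leaf record { cycle = C ; within = within } p refl
    with p₁ , p₂ , p₁≢p₂ , adj₁ , adj₂ ← two-neighbours C p
    = p₁≢p₂ (Cycle.v-inj C (leaf _ _ (within p₁) (within p₂) adj₁ adj₂))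

  remove : (Fin n → Bool) → Fin n → (Fin n → Bool)
  remove U a b = U b ∧ not (does (b Fin.≟ a))

  CycleWithin-remove : ∀ {U a} → IsLeaf U a → CycleWithin U → CycleWithin (remove U a)
  CycleWithin-remove {U} {a} leaf C = record { cycle = cycle ; within = within′ }
    where
    open CycleWithin C
    within′ : ∀ p → remove U a (Cycle.v cycle p) ≡ true
    within′ p rewrite within p with Cycle.v cycle p Fin.≟ a
    ... | yes vₚ≡a = ⊥-elim (leaf-off-cycle leaf C p vₚ≡a)
    ... | no  _    = refl

  peel : ℕ → (Fin n → Bool) → Bool
  peel zero    U = does (Fin.all? λ a → U a Bool.≟ false)
  peel (suc f) U with Fin.any? (λ a → (U a Bool.≟ true) ×-dec IsLeaf? U a)
  ... | yes (a , _) = peel f (remove U a)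
  ... | no  _       = peel zero U

  peel-sound : ∀ f U → T (peel f U) → ¬ CycleWithin U
  peel-sound zero U = emptied⇒acyclic (Fin.all? λ a → U a Bool.≟ false)
    where
    emptied⇒acyclic : (d : Dec (∀ a → U a ≡ false)) → T (does d) → ¬ CycleWithin U
    emptied⇒acyclic (yes U≡∅) _ C with () ← ≡.trans (≡.sym (CycleWithin.within C zero)) (U≡∅ _)
  peel-sound (suc f) U emptied C with Fin.any? (λ a → (U a Bool.≟ true) ×-dec IsLeaf? U a)
  ... | yes (a , _ , leaf) = peel-sound f (remove U a) emptied (CycleWithin-remove leaf C)
  ... | no  _              = peel-sound zero U emptied C

  peelsAway : Bool
  peelsAway = peel n (λ _ → true)

  peelsAway⇒forest : T peelsAway → IsForest n S
  peelsAway⇒forest emptied C = peel-sound n (λ _ → true) emptied (record { cycle = C ; within = λ _ → refl })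

  IsCycle : CycleCandidate n → Set
  IsCycle (m , vs) = (∀ x y → lookup vs x ≡ lookup vs y → x ≡ y)
                   × (∀ i → Adj n S (lookup vs (inject₁ i)) (lookup vs (suc i)))
                   × Adj n S (lookup vs (fromℕ (suc (suc m)))) (lookup vs zero)

  IsCycle? : ∀ c → Dec (IsCycle c)
  IsCycle? (m , vs) = Fin.all? (λ x → Fin.all? λ y → (lookup vs x Fin.≟ lookup vs y) →-dec (x Fin.≟ y))
                ×-dec Fin.all? (λ i → Adj? (lookup vs (inject₁ i)) (lookup vs (suc i)))
                ×-dec Adj? (lookup vs (fromℕ (suc (suc m)))) (lookup vs zero)

  anyCycle : List (CycleCandidate n) → Bool
  anyCycle []       = false
  anyCycle (c ∷ cs) = does (IsCycle? c) ∨ anyCycle cs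

  IsCycle⇒Cycle : ∀ c → IsCycle c → Cycle n S
  IsCycle⇒Cycle (m , vs) (inj , steps , close) =
    record { m = m ; v = lookup vs ; v-inj = inj _ _ ; steps = steps ; close = close }

  anyCycle⇒cycle : ∀ cs → T (anyCycle cs) → Cycle n S
  anyCycle⇒cycle (c ∷ cs) = from (IsCycle? c)
    where
    from : (d : Dec (IsCycle c)) → T (does d ∨ anyCycle cs) → Cycle n S
    from (yes isCycle) _     = IsCycle⇒Cycle c isCycle
    from (no  _)       found = anyCycle⇒cycle cs found

module Squarefree where

  isSquarefree : ∀ {N} → Mono N → Bool
  isSquarefree []      = true
  isSquarefree (x ∷ γ) = (x ℕ.≤ᵇ 1) ∧ isSquarefree γ

  support : ∀ {N} → Mono N → Subset N
  support = Data.Vec.map (ℕ._≡ᵇ 1)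

  isSquarefree-sqfree : ∀ {N} (B : Subset N) → isSquarefree (sqfree B) ≡ true
  isSquarefree-sqfree []          = refl
  isSquarefree-sqfree (true ∷ B)  = isSquarefree-sqfree B
  isSquarefree-sqfree (false ∷ B) = isSquarefree-sqfree B

  support-sqfree : ∀ {N} (B : Subset N) → support (sqfree B) ≡ B
  support-sqfree []          = refl
  support-sqfree (true ∷ B)  = ≡.cong (true ∷_) (support-sqfree B)
  support-sqfree (false ∷ B) = ≡.cong (false ∷_) (support-sqfree B)

  sqfree-support : ∀ {N} (γ : Mono N) → isSquarefree γ ≡ true → sqfree (support γ) ≡ γ
  sqfree-support []               _  = refl
  sqfree-support (zero ∷ γ)       sq = ≡.cong (0 ∷_) (sqfree-support γ sq)
  sqfree-support (suc zero ∷ γ)   sq = ≡.cong (1 ∷_) (sqfree-support γ sq)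

  deg-sqfree : ∀ {N} (B : Subset N) → deg (sqfree B) ≡ ∣ B ∣
  deg-sqfree []          = refl
  deg-sqfree (true ∷ B)  = ≡.cong suc (deg-sqfree B)
  deg-sqfree (false ∷ B) = deg-sqfree B

  2≤⇒¬isSquarefree : ∀ {N} (γ : Mono N) i → 2 ≤ lookup γ i → isSquarefree γ ≡ false
  2≤⇒¬isSquarefree (suc (suc x) ∷ γ) zero    _  = refl
  2≤⇒¬isSquarefree (suc zero ∷ γ)    zero    (s≤s ())
  2≤⇒¬isSquarefree (x ∷ γ)           (suc i) 2≤ rewrite 2≤⇒¬isSquarefree γ i 2≤ = Bool.∧-zeroʳ _

open Squarefree

basisCount : ∀ {N} → ℕ → (Subset N → Bool) → Mono N → ℕ
basisCount r independent γ = if isSquarefree γ ∧ (deg γ ℕ.≡ᵇ r) ∧ independent (support γ) then 1 else 0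

module BasisIndicator (n r : ℕ) (forestᵇ : Subset (#E n) → Bool)
  (forestᵇ-sound    : ∀ B → ∣ B ∣ ≡ r → forestᵇ B ≡ true → IsForest n B)
  (forestᵇ-complete : ∀ B → ∣ B ∣ ≡ r → forestᵇ B ≡ false → ¬ IsForest n B) where

  χ : Mono (#E n) → ℕ
  χ = basisCount r forestᵇ

  χ-squarefree : ∀ γ i → 2 ≤ lookup γ i → χ γ ≡ 0
  χ-squarefree γ i 2≤ rewrite 2≤⇒¬isSquarefree γ i 2≤ = refl

  χ-homogeneous : ∀ γ → deg γ ≢ r → χ γ ≡ 0
  χ-homogeneous γ deg≢r with isSquarefree γ | deg γ ℕ.≡ᵇ r in deg≡ᵇr
  ... | false | _     = refl
  ... | true  | false = refl
  ... | true  | true  = ⊥-elim (deg≢r (ℕₚ.≡ᵇ⇒≡ (deg γ) r (≡.subst T (≡.sym deg≡ᵇr) tt)))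

  module _ {c ℓ} (K : CommutativeRing c ℓ) (Φ : Poly.Coeffs K (#E n)) (Φ-gen : Poly.IsBasisGenPoly K n r Φ) where
    open CommutativeRing K using (_≈_; 1#; trans; sym; +-identityʳ)
    open import Algebra.Properties.Semiring.Mult (CommutativeRing.semiring K) using () renaming (_×_ to _·_)

    Φ≈χ : ∀ γ → Φ γ ≈ χ γ · 1#
    Φ≈χ γ with Φ-gen γ | isSquarefree γ in sq | deg γ ℕ.≡ᵇ r in deg≡ᵇr | forestᵇ (support γ) in forest
    ... | _ , off | false | _ | _ = off λ { (B , refl , _) → false≢true (≡.trans (≡.sym sq) (isSquarefree-sqfree B)) }
      where false≢true : false ≢ true
            false≢true ()
    ... | _ , off | true | false | _ = off λ { (B , refl , card , _) →
      ≡.subst T deg≡ᵇr (ℕₚ.≡⇒≡ᵇ _ r (≡.trans (deg-sqfree B) card)) }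
    ... | _ , off | true | true | false = off λ { (B , refl , card , isForest) →
      forestᵇ-complete B card (≡.trans (≡.cong forestᵇ (≡.sym (support-sqfree B))) forest) isForest }
    ... | on , _ | true | true | true = trans (on (support γ , ≡.sym (sqfree-support γ sq) , card , isForest)) (sym (+-identityʳ 1#))
      where
      card : ∣ support γ ∣ ≡ r
      card = ≡.trans (≡.sym (deg-sqfree (support γ)))
                     (≡.trans (≡.cong deg (sqfree-support γ sq)) (ℕₚ.≡ᵇ⇒≡ (deg γ) r (≡.subst T (≡.sym deg≡ᵇr) tt)))
      isForest = forestᵇ-sound (support γ) card forest

-- a finite set of subsets of a k-element set, as a binary decision tree on the bits
data SubsetTrie : ℕ → Set where
  leaf  : Bool → SubsetTrie zero
  node  : ∀ {k} → SubsetTrie k → SubsetTrie k → SubsetTrie (suc k)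
  empty : ∀ {k} → SubsetTrie k

member : ∀ {k} → SubsetTrie k → Subset k → Bool
member (leaf b)   []          = b
member (node t f) (true ∷ S)  = member t S
member (node t f) (false ∷ S) = member f S
member empty      S           = false

all-subsets? : ∀ {k p} {P : Subset k → Set p} → Decidable P → Dec (∀ S → P S)
all-subsets? {zero}  P? = map′ (λ { P[] [] → P[] }) (λ ∀P → ∀P []) (P? [])
all-subsets? {suc k} P? = map′ (λ { (P⊤ , P⊥) (true ∷ S) → P⊤ S ; (P⊤ , P⊥) (false ∷ S) → P⊥ S })
                               (λ ∀P → (λ S → ∀P (true ∷ S)) , (λ S → ∀P (false ∷ S)))
                               (all-subsets? (P? ∘ (true ∷_)) ×-dec all-subsets? (P? ∘ (false ∷_)))

module _ {n} (r : ℕ) (forests : SubsetTrie (#E n)) (cycles : List (CycleCandidate n)) where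

  Witnessed : Subset (#E n) → Set
  Witnessed S = ∣ S ∣ ≡ r →
    T (if member forests S then Forests.peelsAway n S else Forests.anyCycle n S cycles)

  witnessed? : Decidable Witnessed
  witnessed? S = (∣ S ∣ ℕ.≟ r) →-dec T? _

-- True P? as an equation: refl : does P? ≡ true is checked much faster than tt : True P?
record Decided {p} {P : Set p} (P? : Dec P) : Set where
  constructor by-evaluation
  field evaluates-to-yes : does P? ≡ true

decided⇒ : ∀ {p} {P : Set p} {P? : Dec P} → Decided P? → P
decided⇒ {P? = yes p} _ = p

matrix : ∀ {N} → Vec (Vec ℕ N) N → Fin N → Fin N → ℕ
matrix M m i = lookup (lookup M m) i

-- hessian₀ = r! · #bases represents L^r : A₀ → A_r; hessian₁ represents L^{r-2} : A₁ → A_{r-1},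
-- and (G⁺ − G⁻)/(d + 1) is its inverse.
record Certificate (n r : ℕ) : Set where
  field
    forests           : SubsetTrie (#E n)
    cycles            : List (CycleCandidate n)
    forests-witnessed : Decided (all-subsets? (witnessed? r forests cycles))
    top               : Mono (#E n)
    top-basis         : basisCount r (member forests) top ≡ 1
    hessian₀∸1        : ℕ
    hessian₀≡         : wordSumℕ r (basisCount r (member forests)) ≡ suc hessian₀∸1
    hessian₁ G⁺ G⁻    : Vec (Vec ℕ (#E n)) (#E n)
    d                 : ℕ
    hessian₁-def      : Decided (isHessian? (r ∸ 2) (basisCount r (member forests)) (matrix hessian₁))
    left-inverse      : Decided (isScaledLeftInverse? d (matrix G⁺) (matrix G⁻) (matrix hessian₁))
    right-inverse     : Decided (isScaledRightInverse? d (matrix G⁺) (matrix G⁻) (matrix hessian₁))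

module _ {n r} (cert : Certificate n r) where
  open Certificate cert

  forest-sound : ∀ B → ∣ B ∣ ≡ r → member forests B ≡ true → IsForest n B
  forest-sound B card inForests = Forests.peelsAway⇒forest n B
    (≡.subst (λ b → T (if b then Forests.peelsAway n B else Forests.anyCycle n B cycles)) inForests
             (decided⇒ forests-witnessed B card))

  forest-complete : ∀ B → ∣ B ∣ ≡ r → member forests B ≡ false → ¬ IsForest n B
  forest-complete B card notInForests isForest = isForest (Forests.anyCycle⇒cycle n B cycles
    (≡.subst (λ b → T (if b then Forests.peelsAway n B else Forests.anyCycle n B cycles)) notInForests
             (decided⇒ forests-witnessed B card)))

  module _ (2≤r : 2 ≤ r) (r≤4 : r ≤ 4) {c ℓ} (K : CommutativeRing c ℓ)
           (isField : Poly.IsField K) (charZero : Poly.CharZero K)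
           (Φ : Poly.Coeffs K (#E n)) (Φ-gen : Poly.IsBasisGenPoly K n r Φ) where
    open CommutativeRing K using (1#)
    open Poly K
    open Pairing K using (Homog-linear)
    open BasisIndicator n r (member forests) forest-sound forest-complete
    open Apolarity.SquarefreeForm K isField charZero r Φ χ (Φ≈χ K Φ Φ-gen) χ-squarefree χ-homogeneous

    certified-SLE : IsStrongLefschetzElement Φ sumVars
    certified-SLE = Homog-linear (λ _ → 1#) , r , isTopDegree top 0 top-basis , mulBijective
      where
      mulBijective : ∀ j → j + j ≤ r → MulBijective Φ L (r ∸ (j + j)) j
      mulBijective 0 _   = mulBijective-degree0 hessian₀∸1 hessian₀≡
      mulBijective 1 _   = mulBijective-degree1 (r ∸ 2) (≡.sym (ℕₚ.m+[n∸m]≡n 2≤r))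
                             (matrix hessian₁) (matrix G⁺) (matrix G⁻) d
                             (decided⇒ hessian₁-def) (decided⇒ left-inverse) (decided⇒ right-inverse)
      mulBijective 2 _   = ≡.subst (λ k → MulBijective Φ L k 2) (≡.sym (ℕₚ.m≤n⇒m∸n≡0 r≤4)) (mulBijective-L⁰ 2)
      mulBijective (suc (suc (suc j))) 6+2j≤r with () ← ℕₚ.≤⇒≯ (ℕₚ.≤-trans 6+2j≤r r≤4)
        (s≤s (s≤s (s≤s (ℕₚ.≤-trans (s≤s (s≤s z≤n)) (ℕₚ.m≤n+m (3 + j) j)))))

certificate₄₃ : Certificate 4 3
certificate₄₃ = record
  { forests           =
      node (node (node (node empty (node empty (node (leaf false) (leaf true)))) (node (node empty
      (node (leaf false) (leaf false))) (node (node (leaf false) (leaf true)) (node (leaf true)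
      (leaf false))))) (node (node (node empty (node (leaf false) (leaf true))) (node (node
      (leaf false) (leaf false)) (node (leaf true) (leaf false)))) (node (node (node (leaf false)
      (leaf true)) (node (leaf true) (leaf false))) (node (node (leaf true) (leaf false)) (node
      (leaf false) (leaf false)))))) (node (node (node (node empty (node (leaf false) (leaf true)))
      (node (node (leaf false) (leaf true)) (node (leaf false) (leaf false)))) (node (node (node
      (leaf false) (leaf true)) (node (leaf true) (leaf false))) (node (node (leaf true)
      (leaf false)) (node (leaf false) (leaf false))))) (node (node (node (node (leaf false)
      (leaf true)) (node (leaf true) (leaf false))) (node (node (leaf true) (leaf false)) (node
      (leaf false) (leaf false)))) (node (node (node (leaf false) (leaf false)) (node (leaf false)
      (leaf false))) (node (node (leaf false) (leaf false)) (node (leaf false) (leaf false))))))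
  ; cycles            =
      (0 , # 0 ∷ # 1 ∷ # 2 ∷ [])
      ∷ (0 , # 0 ∷ # 1 ∷ # 3 ∷ [])
      ∷ (0 , # 0 ∷ # 2 ∷ # 3 ∷ [])
      ∷ (0 , # 1 ∷ # 2 ∷ # 3 ∷ [])
      ∷ (1 , # 0 ∷ # 1 ∷ # 2 ∷ # 3 ∷ [])
      ∷ (1 , # 0 ∷ # 1 ∷ # 3 ∷ # 2 ∷ [])
      ∷ (1 , # 0 ∷ # 2 ∷ # 1 ∷ # 3 ∷ [])
      ∷ []
  ; forests-witnessed = by-evaluation refl
  ; top               = 1 ∷ 1 ∷ 1 ∷ 0 ∷ 0 ∷ 0 ∷ []
  ; top-basis         = refl
  ; hessian₀∸1        = 95
  ; hessian₀≡         = refl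
  ; hessian₁          = (0 ∷ 3 ∷ 3 ∷ 3 ∷ 3 ∷ 4 ∷ []) ∷
                        (3 ∷ 0 ∷ 3 ∷ 3 ∷ 4 ∷ 3 ∷ []) ∷
                        (3 ∷ 3 ∷ 0 ∷ 4 ∷ 3 ∷ 3 ∷ []) ∷
                        (3 ∷ 3 ∷ 4 ∷ 0 ∷ 3 ∷ 3 ∷ []) ∷
                        (3 ∷ 4 ∷ 3 ∷ 3 ∷ 0 ∷ 3 ∷ []) ∷
                        (4 ∷ 3 ∷ 3 ∷ 3 ∷ 3 ∷ 0 ∷ []) ∷ []
  ; G⁺                = (0 ∷ 3 ∷ 3 ∷ 3 ∷ 3 ∷ 0 ∷ []) ∷
                        (3 ∷ 0 ∷ 3 ∷ 3 ∷ 0 ∷ 3 ∷ []) ∷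
                        (3 ∷ 3 ∷ 0 ∷ 0 ∷ 3 ∷ 3 ∷ []) ∷
                        (3 ∷ 3 ∷ 0 ∷ 0 ∷ 3 ∷ 3 ∷ []) ∷
                        (3 ∷ 0 ∷ 3 ∷ 3 ∷ 0 ∷ 3 ∷ []) ∷
                        (0 ∷ 3 ∷ 3 ∷ 3 ∷ 3 ∷ 0 ∷ []) ∷ []
  ; G⁻                = (9 ∷ 0 ∷ 0 ∷ 0 ∷ 0 ∷ 1 ∷ []) ∷
                        (0 ∷ 9 ∷ 0 ∷ 0 ∷ 1 ∷ 0 ∷ []) ∷
                        (0 ∷ 0 ∷ 9 ∷ 1 ∷ 0 ∷ 0 ∷ []) ∷
                        (0 ∷ 0 ∷ 1 ∷ 9 ∷ 0 ∷ 0 ∷ []) ∷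
                        (0 ∷ 1 ∷ 0 ∷ 0 ∷ 9 ∷ 0 ∷ []) ∷
                        (1 ∷ 0 ∷ 0 ∷ 0 ∷ 0 ∷ 9 ∷ []) ∷ []
  ; d                 = 31
  ; hessian₁-def      = by-evaluation refl
  ; left-inverse      = by-evaluation refl
  ; right-inverse     = by-evaluation refl
  }

certificate₅₃ : Certificate 5 3
certificate₅₃ = record
  { forests           =
      node (node (node (node empty (node empty (node empty (node empty (node empty (node empty
      (node (leaf false) (leaf true)))))))) (node (node empty (node empty (node empty (node empty
      (node empty (node (leaf false) (leaf true))))))) (node (node empty (node empty (node empty
      (node empty (node (leaf false) (leaf false)))))) (node (node empty (node empty (node empty
      (node (leaf false) (leaf true))))) (node (node empty (node empty (node (leaf false)
      (leaf true)))) (node (node empty (node (leaf false) (leaf true))) (node (node (leaf false)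
      (leaf true)) (node (leaf true) (leaf false))))))))) (node (node (node empty (node empty (node
      empty (node empty (node empty (node (leaf false) (leaf true))))))) (node (node empty (node
      empty (node empty (node empty (node (leaf false) (leaf true)))))) (node (node empty (node
      empty (node empty (node (leaf false) (leaf false))))) (node (node empty (node empty (node
      (leaf false) (leaf true)))) (node (node empty (node (leaf false) (leaf true))) (node (node
      (leaf false) (leaf true)) (node (leaf true) (leaf false)))))))) (node (node (node empty (node
      empty (node empty (node empty (node (leaf false) (leaf true)))))) (node (node empty (node
      empty (node empty (node (leaf false) (leaf true))))) (node (node empty (node empty (node
      (leaf false) (leaf false)))) (node (node empty (node (leaf false) (leaf true))) (node (node
      (leaf false) (leaf true)) (node (leaf true) (leaf false))))))) (node (node (node empty (node
      empty (node empty (node (leaf false) (leaf true))))) (node (node empty (node empty (node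
      (leaf false) (leaf true)))) (node (node empty (node (leaf false) (leaf true))) (node (node
      (leaf false) (leaf true)) (node (leaf true) (leaf false)))))) (node (node (node empty (node
      empty (node (leaf false) (leaf true)))) (node (node empty (node (leaf false) (leaf true)))
      (node (node (leaf false) (leaf true)) (node (leaf true) (leaf false))))) (node (node (node
      empty (node (leaf false) (leaf true))) (node (node (leaf false) (leaf true)) (node
      (leaf true) (leaf false)))) (node (node (node (leaf false) (leaf true)) (node (leaf true)
      (leaf false))) (node (node (leaf true) (leaf false)) (node (leaf false) (leaf false))))))))))
      (node (node (node (node empty (node empty (node empty (node empty (node empty (node
      (leaf false) (leaf true))))))) (node (node empty (node empty (node empty (node empty (node
      (leaf false) (leaf true)))))) (node (node empty (node empty (node empty (node (leaf false)
      (leaf true))))) (node (node empty (node empty (node (leaf false) (leaf true)))) (node (node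
      empty (node (leaf false) (leaf false))) (node (node (leaf false) (leaf true)) (node
      (leaf true) (leaf false)))))))) (node (node (node empty (node empty (node empty (node empty
      (node (leaf false) (leaf true)))))) (node (node empty (node empty (node empty (node
      (leaf false) (leaf true))))) (node (node empty (node empty (node (leaf false) (leaf true))))
      (node (node empty (node (leaf false) (leaf true))) (node (node (leaf false) (leaf false))
      (node (leaf true) (leaf false))))))) (node (node (node empty (node empty (node empty (node
      (leaf false) (leaf true))))) (node (node empty (node empty (node (leaf false) (leaf true))))
      (node (node empty (node (leaf false) (leaf true))) (node (node (leaf false) (leaf true))
      (node (leaf true) (leaf false)))))) (node (node (node empty (node empty (node (leaf false)
      (leaf true)))) (node (node empty (node (leaf false) (leaf true))) (node (node (leaf false)
      (leaf true)) (node (leaf true) (leaf false))))) (node (node (node empty (node (leaf false)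
      (leaf true))) (node (node (leaf false) (leaf true)) (node (leaf true) (leaf false)))) (node
      (node (node (leaf false) (leaf true)) (node (leaf true) (leaf false))) (node (node
      (leaf true) (leaf false)) (node (leaf false) (leaf false))))))))) (node (node (node (node
      empty (node empty (node empty (node empty (node (leaf false) (leaf true)))))) (node (node
      empty (node empty (node empty (node (leaf false) (leaf true))))) (node (node empty (node
      empty (node (leaf false) (leaf true)))) (node (node empty (node (leaf false) (leaf true)))
      (node (node (leaf false) (leaf true)) (node (leaf false) (leaf false))))))) (node (node (node
      empty (node empty (node empty (node (leaf false) (leaf true))))) (node (node empty (node
      empty (node (leaf false) (leaf true)))) (node (node empty (node (leaf false) (leaf true)))
      (node (node (leaf false) (leaf true)) (node (leaf true) (leaf false)))))) (node (node (node
      empty (node empty (node (leaf false) (leaf true)))) (node (node empty (node (leaf false)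
      (leaf true))) (node (node (leaf false) (leaf true)) (node (leaf true) (leaf false))))) (node
      (node (node empty (node (leaf false) (leaf true))) (node (node (leaf false) (leaf true))
      (node (leaf true) (leaf false)))) (node (node (node (leaf false) (leaf true)) (node
      (leaf true) (leaf false))) (node (node (leaf true) (leaf false)) (node (leaf false)
      (leaf false)))))))) (node (node (node (node empty (node empty (node empty (node (leaf false)
      (leaf true))))) (node (node empty (node empty (node (leaf false) (leaf true)))) (node (node
      empty (node (leaf false) (leaf true))) (node (node (leaf false) (leaf true)) (node
      (leaf true) (leaf false)))))) (node (node (node empty (node empty (node (leaf false)
      (leaf true)))) (node (node empty (node (leaf false) (leaf true))) (node (node (leaf false)
      (leaf true)) (node (leaf true) (leaf false))))) (node (node (node empty (node (leaf false)
      (leaf true))) (node (node (leaf false) (leaf true)) (node (leaf true) (leaf false)))) (node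
      (node (node (leaf false) (leaf true)) (node (leaf true) (leaf false))) (node (node
      (leaf true) (leaf false)) (node (leaf false) (leaf false))))))) (node (node (node (node empty
      (node empty (node (leaf false) (leaf true)))) (node (node empty (node (leaf false)
      (leaf false))) (node (node (leaf false) (leaf true)) (node (leaf true) (leaf false))))) (node
      (node (node empty (node (leaf false) (leaf true))) (node (node (leaf false) (leaf false))
      (node (leaf true) (leaf false)))) (node (node (node (leaf false) (leaf true)) (node
      (leaf true) (leaf false))) (node (node (leaf true) (leaf false)) (node (leaf false)
      (leaf false)))))) (node (node (node (node empty (node (leaf false) (leaf true))) (node (node
      (leaf false) (leaf true)) (node (leaf false) (leaf false)))) (node (node (node (leaf false)
      (leaf true)) (node (leaf true) (leaf false))) (node (node (leaf true) (leaf false)) (node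
      (leaf false) (leaf false))))) (node (node (node (node (leaf false) (leaf true)) (node
      (leaf true) (leaf false))) (node (node (leaf true) (leaf false)) (node (leaf false)
      (leaf false)))) (node (node (node (leaf false) (leaf false)) (node (leaf false)
      (leaf false))) (node (node (leaf false) (leaf false)) (node (leaf false)
      (leaf false))))))))))
  ; cycles            =
      (0 , # 0 ∷ # 1 ∷ # 2 ∷ [])
      ∷ (0 , # 0 ∷ # 1 ∷ # 3 ∷ [])
      ∷ (0 , # 0 ∷ # 1 ∷ # 4 ∷ [])
      ∷ (0 , # 0 ∷ # 2 ∷ # 3 ∷ [])
      ∷ (0 , # 0 ∷ # 2 ∷ # 4 ∷ [])
      ∷ (0 , # 0 ∷ # 3 ∷ # 4 ∷ [])
      ∷ (0 , # 1 ∷ # 2 ∷ # 3 ∷ [])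
      ∷ (0 , # 1 ∷ # 2 ∷ # 4 ∷ [])
      ∷ (0 , # 1 ∷ # 3 ∷ # 4 ∷ [])
      ∷ (0 , # 2 ∷ # 3 ∷ # 4 ∷ [])
      ∷ (1 , # 0 ∷ # 1 ∷ # 2 ∷ # 3 ∷ [])
      ∷ (1 , # 0 ∷ # 1 ∷ # 3 ∷ # 2 ∷ [])
      ∷ (1 , # 0 ∷ # 2 ∷ # 1 ∷ # 3 ∷ [])
      ∷ (1 , # 0 ∷ # 1 ∷ # 2 ∷ # 4 ∷ [])
      ∷ (1 , # 0 ∷ # 1 ∷ # 4 ∷ # 2 ∷ [])
      ∷ (1 , # 0 ∷ # 2 ∷ # 1 ∷ # 4 ∷ [])
      ∷ (1 , # 0 ∷ # 1 ∷ # 3 ∷ # 4 ∷ [])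
      ∷ (1 , # 0 ∷ # 1 ∷ # 4 ∷ # 3 ∷ [])
      ∷ (1 , # 0 ∷ # 3 ∷ # 1 ∷ # 4 ∷ [])
      ∷ (1 , # 0 ∷ # 2 ∷ # 3 ∷ # 4 ∷ [])
      ∷ (1 , # 0 ∷ # 2 ∷ # 4 ∷ # 3 ∷ [])
      ∷ (1 , # 0 ∷ # 3 ∷ # 2 ∷ # 4 ∷ [])
      ∷ (1 , # 1 ∷ # 2 ∷ # 3 ∷ # 4 ∷ [])
      ∷ (1 , # 1 ∷ # 2 ∷ # 4 ∷ # 3 ∷ [])
      ∷ (1 , # 1 ∷ # 3 ∷ # 2 ∷ # 4 ∷ [])
      ∷ []
  ; forests-witnessed = by-evaluation refl
  ; top               = 1 ∷ 1 ∷ 1 ∷ 0 ∷ 0 ∷ 0 ∷ 0 ∷ 0 ∷ 0 ∷ 0 ∷ []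
  ; top-basis         = refl
  ; hessian₀∸1        = 659
  ; hessian₀≡         = refl
  ; hessian₁          = (0 ∷ 7 ∷ 7 ∷ 7 ∷ 7 ∷ 7 ∷ 7 ∷ 8 ∷ 8 ∷ 8 ∷ []) ∷
                        (7 ∷ 0 ∷ 7 ∷ 7 ∷ 7 ∷ 8 ∷ 8 ∷ 7 ∷ 7 ∷ 8 ∷ []) ∷
                        (7 ∷ 7 ∷ 0 ∷ 7 ∷ 8 ∷ 7 ∷ 8 ∷ 7 ∷ 8 ∷ 7 ∷ []) ∷
                        (7 ∷ 7 ∷ 7 ∷ 0 ∷ 8 ∷ 8 ∷ 7 ∷ 8 ∷ 7 ∷ 7 ∷ []) ∷
                        (7 ∷ 7 ∷ 8 ∷ 8 ∷ 0 ∷ 7 ∷ 7 ∷ 7 ∷ 7 ∷ 8 ∷ []) ∷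
                        (7 ∷ 8 ∷ 7 ∷ 8 ∷ 7 ∷ 0 ∷ 7 ∷ 7 ∷ 8 ∷ 7 ∷ []) ∷
                        (7 ∷ 8 ∷ 8 ∷ 7 ∷ 7 ∷ 7 ∷ 0 ∷ 8 ∷ 7 ∷ 7 ∷ []) ∷
                        (8 ∷ 7 ∷ 7 ∷ 8 ∷ 7 ∷ 7 ∷ 8 ∷ 0 ∷ 7 ∷ 7 ∷ []) ∷
                        (8 ∷ 7 ∷ 8 ∷ 7 ∷ 7 ∷ 8 ∷ 7 ∷ 7 ∷ 0 ∷ 7 ∷ []) ∷
                        (8 ∷ 8 ∷ 7 ∷ 7 ∷ 8 ∷ 7 ∷ 7 ∷ 7 ∷ 7 ∷ 0 ∷ []) ∷ []
  ; G⁺                = (0 ∷ 13 ∷ 13 ∷ 13 ∷ 13 ∷ 13 ∷ 13 ∷ 2 ∷ 2 ∷ 2 ∷ []) ∷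
                        (13 ∷ 0 ∷ 13 ∷ 13 ∷ 13 ∷ 2 ∷ 2 ∷ 13 ∷ 13 ∷ 2 ∷ []) ∷
                        (13 ∷ 13 ∷ 0 ∷ 13 ∷ 2 ∷ 13 ∷ 2 ∷ 13 ∷ 2 ∷ 13 ∷ []) ∷
                        (13 ∷ 13 ∷ 13 ∷ 0 ∷ 2 ∷ 2 ∷ 13 ∷ 2 ∷ 13 ∷ 13 ∷ []) ∷
                        (13 ∷ 13 ∷ 2 ∷ 2 ∷ 0 ∷ 13 ∷ 13 ∷ 13 ∷ 13 ∷ 2 ∷ []) ∷
                        (13 ∷ 2 ∷ 13 ∷ 2 ∷ 13 ∷ 0 ∷ 13 ∷ 13 ∷ 2 ∷ 13 ∷ []) ∷
                        (13 ∷ 2 ∷ 2 ∷ 13 ∷ 13 ∷ 13 ∷ 0 ∷ 2 ∷ 13 ∷ 13 ∷ []) ∷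
                        (2 ∷ 13 ∷ 13 ∷ 2 ∷ 13 ∷ 13 ∷ 2 ∷ 0 ∷ 13 ∷ 13 ∷ []) ∷
                        (2 ∷ 13 ∷ 2 ∷ 13 ∷ 13 ∷ 2 ∷ 13 ∷ 13 ∷ 0 ∷ 13 ∷ []) ∷
                        (2 ∷ 2 ∷ 13 ∷ 13 ∷ 2 ∷ 13 ∷ 13 ∷ 13 ∷ 13 ∷ 0 ∷ []) ∷ []
  ; G⁻                = (75 ∷ 0 ∷ 0 ∷ 0 ∷ 0 ∷ 0 ∷ 0 ∷ 0 ∷ 0 ∷ 0 ∷ []) ∷
                        (0 ∷ 75 ∷ 0 ∷ 0 ∷ 0 ∷ 0 ∷ 0 ∷ 0 ∷ 0 ∷ 0 ∷ []) ∷
                        (0 ∷ 0 ∷ 75 ∷ 0 ∷ 0 ∷ 0 ∷ 0 ∷ 0 ∷ 0 ∷ 0 ∷ []) ∷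
                        (0 ∷ 0 ∷ 0 ∷ 75 ∷ 0 ∷ 0 ∷ 0 ∷ 0 ∷ 0 ∷ 0 ∷ []) ∷
                        (0 ∷ 0 ∷ 0 ∷ 0 ∷ 75 ∷ 0 ∷ 0 ∷ 0 ∷ 0 ∷ 0 ∷ []) ∷
                        (0 ∷ 0 ∷ 0 ∷ 0 ∷ 0 ∷ 75 ∷ 0 ∷ 0 ∷ 0 ∷ 0 ∷ []) ∷
                        (0 ∷ 0 ∷ 0 ∷ 0 ∷ 0 ∷ 0 ∷ 75 ∷ 0 ∷ 0 ∷ 0 ∷ []) ∷
                        (0 ∷ 0 ∷ 0 ∷ 0 ∷ 0 ∷ 0 ∷ 0 ∷ 75 ∷ 0 ∷ 0 ∷ []) ∷
                        (0 ∷ 0 ∷ 0 ∷ 0 ∷ 0 ∷ 0 ∷ 0 ∷ 0 ∷ 75 ∷ 0 ∷ []) ∷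
                        (0 ∷ 0 ∷ 0 ∷ 0 ∷ 0 ∷ 0 ∷ 0 ∷ 0 ∷ 0 ∷ 75 ∷ []) ∷ []
  ; d                 = 593
  ; hessian₁-def      = by-evaluation refl
  ; left-inverse      = by-evaluation refl
  ; right-inverse     = by-evaluation refl
  }

certificate₅₄ : Certificate 5 4
certificate₅₄ = record
  { forests           =
      node (node (node (node (node empty (node empty (node empty (node empty (node empty (node
      (leaf false) (leaf true))))))) (node (node empty (node empty (node empty (node empty (node
      (leaf false) (leaf false)))))) (node (node empty (node empty (node empty (node (leaf false)
      (leaf false))))) (node (node empty (node empty (node (leaf false) (leaf true)))) (node (node
      empty (node (leaf false) (leaf false))) (node (node (leaf false) (leaf true)) (node
      (leaf true) (leaf false)))))))) (node (node (node empty (node empty (node empty (node empty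
      (node (leaf false) (leaf false)))))) (node (node empty (node empty (node empty (node
      (leaf false) (leaf true))))) (node (node empty (node empty (node (leaf false) (leaf false))))
      (node (node empty (node (leaf false) (leaf true))) (node (node (leaf false) (leaf false))
      (node (leaf true) (leaf false))))))) (node (node (node empty (node empty (node empty (node
      (leaf false) (leaf false))))) (node (node empty (node empty (node (leaf false)
      (leaf false)))) (node (node empty (node (leaf false) (leaf false))) (node (node (leaf false)
      (leaf false)) (node (leaf false) (leaf false)))))) (node (node (node empty (node empty (node
      (leaf false) (leaf true)))) (node (node empty (node (leaf false) (leaf false))) (node (node
      (leaf false) (leaf true)) (node (leaf true) (leaf false))))) (node (node (node empty (node
      (leaf false) (leaf true))) (node (node (leaf false) (leaf false)) (node (leaf true)
      (leaf false)))) (node (node (node (leaf false) (leaf true)) (node (leaf true) (leaf false)))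
      (node (node (leaf true) (leaf false)) (node (leaf false) (leaf false))))))))) (node (node
      (node (node empty (node empty (node empty (node empty (node (leaf false) (leaf true))))))
      (node (node empty (node empty (node empty (node (leaf false) (leaf false))))) (node (node
      empty (node empty (node (leaf false) (leaf false)))) (node (node empty (node (leaf false)
      (leaf true))) (node (node (leaf false) (leaf true)) (node (leaf false) (leaf false)))))))
      (node (node (node empty (node empty (node empty (node (leaf false) (leaf false))))) (node
      (node empty (node empty (node (leaf false) (leaf true)))) (node (node empty (node
      (leaf false) (leaf false))) (node (node (leaf false) (leaf true)) (node (leaf true)
      (leaf false)))))) (node (node (node empty (node empty (node (leaf false) (leaf false))))
      (node (node empty (node (leaf false) (leaf false))) (node (node (leaf false) (leaf false))
      (node (leaf false) (leaf false))))) (node (node (node empty (node (leaf false) (leaf true)))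
      (node (node (leaf false) (leaf true)) (node (leaf false) (leaf false)))) (node (node (node
      (leaf false) (leaf true)) (node (leaf true) (leaf false))) (node (node (leaf true)
      (leaf false)) (node (leaf false) (leaf false)))))))) (node (node (node (node empty (node
      empty (node empty (node (leaf false) (leaf true))))) (node (node empty (node empty (node
      (leaf false) (leaf false)))) (node (node empty (node (leaf false) (leaf true))) (node (node
      (leaf false) (leaf false)) (node (leaf true) (leaf false)))))) (node (node (node empty (node
      empty (node (leaf false) (leaf false)))) (node (node empty (node (leaf false) (leaf true)))
      (node (node (leaf false) (leaf true)) (node (leaf false) (leaf false))))) (node (node (node
      empty (node (leaf false) (leaf false))) (node (node (leaf false) (leaf false)) (node
      (leaf false) (leaf false)))) (node (node (node (leaf false) (leaf true)) (node (leaf true)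
      (leaf false))) (node (node (leaf true) (leaf false)) (node (leaf false) (leaf false)))))))
      (node (node (node (node empty (node empty (node (leaf false) (leaf true)))) (node (node empty
      (node (leaf false) (leaf false))) (node (node (leaf false) (leaf true)) (node (leaf true)
      (leaf false))))) (node (node (node empty (node (leaf false) (leaf true))) (node (node
      (leaf false) (leaf false)) (node (leaf true) (leaf false)))) (node (node (node (leaf false)
      (leaf true)) (node (leaf true) (leaf false))) (node (node (leaf true) (leaf false)) (node
      (leaf false) (leaf false)))))) (node (node (node (node empty (node (leaf false) (leaf true)))
      (node (node (leaf false) (leaf true)) (node (leaf false) (leaf false)))) (node (node (node
      (leaf false) (leaf true)) (node (leaf true) (leaf false))) (node (node (leaf true)
      (leaf false)) (node (leaf false) (leaf false))))) (node (node (node (node (leaf false)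
      (leaf true)) (node (leaf true) (leaf false))) (node (node (leaf true) (leaf false)) (node
      (leaf false) (leaf false)))) (node (node (node (leaf false) (leaf false)) (node (leaf false)
      (leaf false))) (node (node (leaf false) (leaf false)) (node (leaf false)
      (leaf false)))))))))) (node (node (node (node (node empty (node empty (node empty (node empty
      (node (leaf false) (leaf true)))))) (node (node empty (node empty (node empty (node
      (leaf false) (leaf true))))) (node (node empty (node empty (node (leaf false) (leaf true))))
      (node (node empty (node (leaf false) (leaf false))) (node (node (leaf false) (leaf false))
      (node (leaf false) (leaf false))))))) (node (node (node empty (node empty (node empty (node
      (leaf false) (leaf false))))) (node (node empty (node empty (node (leaf false) (leaf true))))
      (node (node empty (node (leaf false) (leaf false))) (node (node (leaf false) (leaf true))
      (node (leaf true) (leaf false)))))) (node (node (node empty (node empty (node (leaf false)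
      (leaf true)))) (node (node empty (node (leaf false) (leaf false))) (node (node (leaf false)
      (leaf true)) (node (leaf true) (leaf false))))) (node (node (node empty (node (leaf false)
      (leaf false))) (node (node (leaf false) (leaf true)) (node (leaf true) (leaf false)))) (node
      (node (node (leaf false) (leaf false)) (node (leaf false) (leaf false))) (node (node
      (leaf false) (leaf false)) (node (leaf false) (leaf false)))))))) (node (node (node (node
      empty (node empty (node empty (node (leaf false) (leaf true))))) (node (node empty (node
      empty (node (leaf false) (leaf false)))) (node (node empty (node (leaf false) (leaf true)))
      (node (node (leaf false) (leaf false)) (node (leaf true) (leaf false)))))) (node (node (node
      empty (node empty (node (leaf false) (leaf true)))) (node (node empty (node (leaf false)
      (leaf true))) (node (node (leaf false) (leaf false)) (node (leaf true) (leaf false))))) (node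
      (node (node empty (node (leaf false) (leaf true))) (node (node (leaf false) (leaf false))
      (node (leaf true) (leaf false)))) (node (node (node (leaf false) (leaf false)) (node
      (leaf false) (leaf false))) (node (node (leaf false) (leaf false)) (node (leaf false)
      (leaf false))))))) (node (node (node (node empty (node empty (node (leaf false)
      (leaf true)))) (node (node empty (node (leaf false) (leaf false))) (node (node (leaf false)
      (leaf true)) (node (leaf true) (leaf false))))) (node (node (node empty (node (leaf false)
      (leaf true))) (node (node (leaf false) (leaf false)) (node (leaf true) (leaf false)))) (node
      (node (node (leaf false) (leaf true)) (node (leaf true) (leaf false))) (node (node
      (leaf true) (leaf false)) (node (leaf false) (leaf false)))))) (node (node (node (node empty
      (node (leaf false) (leaf true))) (node (node (leaf false) (leaf true)) (node (leaf false)
      (leaf false)))) (node (node (node (leaf false) (leaf true)) (node (leaf true) (leaf false)))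
      (node (node (leaf true) (leaf false)) (node (leaf false) (leaf false))))) (node (node (node
      (node (leaf false) (leaf true)) (node (leaf true) (leaf false))) (node (node (leaf true)
      (leaf false)) (node (leaf false) (leaf false)))) (node (node (node (leaf false) (leaf false))
      (node (leaf false) (leaf false))) (node (node (leaf false) (leaf false)) (node (leaf false)
      (leaf false))))))))) (node (node (node (node (node empty (node empty (node empty (node
      (leaf false) (leaf true))))) (node (node empty (node empty (node (leaf false) (leaf true))))
      (node (node empty (node (leaf false) (leaf true))) (node (node (leaf false) (leaf true))
      (node (leaf false) (leaf false)))))) (node (node (node empty (node empty (node (leaf false)
      (leaf false)))) (node (node empty (node (leaf false) (leaf true))) (node (node (leaf false)
      (leaf true)) (node (leaf false) (leaf false))))) (node (node (node empty (node (leaf false)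
      (leaf true))) (node (node (leaf false) (leaf true)) (node (leaf false) (leaf false)))) (node
      (node (node (leaf false) (leaf false)) (node (leaf false) (leaf false))) (node (node
      (leaf false) (leaf false)) (node (leaf false) (leaf false))))))) (node (node (node (node
      empty (node empty (node (leaf false) (leaf true)))) (node (node empty (node (leaf false)
      (leaf false))) (node (node (leaf false) (leaf true)) (node (leaf true) (leaf false))))) (node
      (node (node empty (node (leaf false) (leaf true))) (node (node (leaf false) (leaf false))
      (node (leaf true) (leaf false)))) (node (node (node (leaf false) (leaf true)) (node
      (leaf true) (leaf false))) (node (node (leaf true) (leaf false)) (node (leaf false)
      (leaf false)))))) (node (node (node (node empty (node (leaf false) (leaf true))) (node (node
      (leaf false) (leaf true)) (node (leaf false) (leaf false)))) (node (node (node (leaf false)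
      (leaf true)) (node (leaf true) (leaf false))) (node (node (leaf true) (leaf false)) (node
      (leaf false) (leaf false))))) (node (node (node (node (leaf false) (leaf true)) (node
      (leaf true) (leaf false))) (node (node (leaf true) (leaf false)) (node (leaf false)
      (leaf false)))) (node (node (node (leaf false) (leaf false)) (node (leaf false)
      (leaf false))) (node (node (leaf false) (leaf false)) (node (leaf false) (leaf false))))))))
      (node (node (node (node (node empty (node empty (node (leaf false) (leaf true)))) (node (node
      empty (node (leaf false) (leaf false))) (node (node (leaf false) (leaf true)) (node
      (leaf true) (leaf false))))) (node (node (node empty (node (leaf false) (leaf true))) (node
      (node (leaf false) (leaf false)) (node (leaf true) (leaf false)))) (node (node (node
      (leaf false) (leaf true)) (node (leaf true) (leaf false))) (node (node (leaf true)
      (leaf false)) (node (leaf false) (leaf false)))))) (node (node (node (node empty (node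
      (leaf false) (leaf true))) (node (node (leaf false) (leaf true)) (node (leaf false)
      (leaf false)))) (node (node (node (leaf false) (leaf true)) (node (leaf true) (leaf false)))
      (node (node (leaf true) (leaf false)) (node (leaf false) (leaf false))))) (node (node (node
      (node (leaf false) (leaf true)) (node (leaf true) (leaf false))) (node (node (leaf true)
      (leaf false)) (node (leaf false) (leaf false)))) (node (node (node (leaf false) (leaf false))
      (node (leaf false) (leaf false))) (node (node (leaf false) (leaf false)) (node (leaf false)
      (leaf false))))))) (node (node (node (node (node empty (node (leaf false) (leaf false)))
      (node (node (leaf false) (leaf false)) (node (leaf false) (leaf false)))) (node (node (node
      (leaf false) (leaf false)) (node (leaf false) (leaf false))) (node (node (leaf false)
      (leaf false)) (node (leaf false) (leaf false))))) (node (node (node (node (leaf false)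
      (leaf false)) (node (leaf false) (leaf false))) (node (node (leaf false) (leaf false)) (node
      (leaf false) (leaf false)))) (node (node (node (leaf false) (leaf false)) (node (leaf false)
      (leaf false))) (node (node (leaf false) (leaf false)) (node (leaf false) (leaf false))))))
      (node (node (node (node (node (leaf false) (leaf false)) (node (leaf false) (leaf false)))
      (node (node (leaf false) (leaf false)) (node (leaf false) (leaf false)))) (node (node (node
      (leaf false) (leaf false)) (node (leaf false) (leaf false))) (node (node (leaf false)
      (leaf false)) (node (leaf false) (leaf false))))) (node (node (node (node (leaf false)
      (leaf false)) (node (leaf false) (leaf false))) (node (node (leaf false) (leaf false)) (node
      (leaf false) (leaf false)))) (node (node (node (leaf false) (leaf false)) (node (leaf false)
      (leaf false))) (node (node (leaf false) (leaf false)) (node (leaf false)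
      (leaf false))))))))))
  ; cycles            =
      (0 , # 0 ∷ # 1 ∷ # 2 ∷ [])
      ∷ (0 , # 0 ∷ # 1 ∷ # 3 ∷ [])
      ∷ (0 , # 0 ∷ # 1 ∷ # 4 ∷ [])
      ∷ (0 , # 0 ∷ # 2 ∷ # 3 ∷ [])
      ∷ (0 , # 0 ∷ # 2 ∷ # 4 ∷ [])
      ∷ (0 , # 0 ∷ # 3 ∷ # 4 ∷ [])
      ∷ (0 , # 1 ∷ # 2 ∷ # 3 ∷ [])
      ∷ (0 , # 1 ∷ # 2 ∷ # 4 ∷ [])
      ∷ (0 , # 1 ∷ # 3 ∷ # 4 ∷ [])
      ∷ (0 , # 2 ∷ # 3 ∷ # 4 ∷ [])
      ∷ (1 , # 0 ∷ # 1 ∷ # 2 ∷ # 3 ∷ [])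
      ∷ (1 , # 0 ∷ # 1 ∷ # 3 ∷ # 2 ∷ [])
      ∷ (1 , # 0 ∷ # 2 ∷ # 1 ∷ # 3 ∷ [])
      ∷ (1 , # 0 ∷ # 1 ∷ # 2 ∷ # 4 ∷ [])
      ∷ (1 , # 0 ∷ # 1 ∷ # 4 ∷ # 2 ∷ [])
      ∷ (1 , # 0 ∷ # 2 ∷ # 1 ∷ # 4 ∷ [])
      ∷ (1 , # 0 ∷ # 1 ∷ # 3 ∷ # 4 ∷ [])
      ∷ (1 , # 0 ∷ # 1 ∷ # 4 ∷ # 3 ∷ [])
      ∷ (1 , # 0 ∷ # 3 ∷ # 1 ∷ # 4 ∷ [])
      ∷ (1 , # 0 ∷ # 2 ∷ # 3 ∷ # 4 ∷ [])
      ∷ (1 , # 0 ∷ # 2 ∷ # 4 ∷ # 3 ∷ [])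
      ∷ (1 , # 0 ∷ # 3 ∷ # 2 ∷ # 4 ∷ [])
      ∷ (1 , # 1 ∷ # 2 ∷ # 3 ∷ # 4 ∷ [])
      ∷ (1 , # 1 ∷ # 2 ∷ # 4 ∷ # 3 ∷ [])
      ∷ (1 , # 1 ∷ # 3 ∷ # 2 ∷ # 4 ∷ [])
      ∷ []
  ; forests-witnessed = by-evaluation refl
  ; top               = 1 ∷ 1 ∷ 1 ∷ 1 ∷ 0 ∷ 0 ∷ 0 ∷ 0 ∷ 0 ∷ 0 ∷ []
  ; top-basis         = refl
  ; hessian₀∸1        = 2999
  ; hessian₀≡         = refl
  ; hessian₁          = (0 ∷ 30 ∷ 30 ∷ 30 ∷ 30 ∷ 30 ∷ 30 ∷ 40 ∷ 40 ∷ 40 ∷ []) ∷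
                        (30 ∷ 0 ∷ 30 ∷ 30 ∷ 30 ∷ 40 ∷ 40 ∷ 30 ∷ 30 ∷ 40 ∷ []) ∷
                        (30 ∷ 30 ∷ 0 ∷ 30 ∷ 40 ∷ 30 ∷ 40 ∷ 30 ∷ 40 ∷ 30 ∷ []) ∷
                        (30 ∷ 30 ∷ 30 ∷ 0 ∷ 40 ∷ 40 ∷ 30 ∷ 40 ∷ 30 ∷ 30 ∷ []) ∷
                        (30 ∷ 30 ∷ 40 ∷ 40 ∷ 0 ∷ 30 ∷ 30 ∷ 30 ∷ 30 ∷ 40 ∷ []) ∷
                        (30 ∷ 40 ∷ 30 ∷ 40 ∷ 30 ∷ 0 ∷ 30 ∷ 30 ∷ 40 ∷ 30 ∷ []) ∷
                        (30 ∷ 40 ∷ 40 ∷ 30 ∷ 30 ∷ 30 ∷ 0 ∷ 40 ∷ 30 ∷ 30 ∷ []) ∷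
                        (40 ∷ 30 ∷ 30 ∷ 40 ∷ 30 ∷ 30 ∷ 40 ∷ 0 ∷ 30 ∷ 30 ∷ []) ∷
                        (40 ∷ 30 ∷ 40 ∷ 30 ∷ 30 ∷ 40 ∷ 30 ∷ 30 ∷ 0 ∷ 30 ∷ []) ∷
                        (40 ∷ 40 ∷ 30 ∷ 30 ∷ 40 ∷ 30 ∷ 30 ∷ 30 ∷ 30 ∷ 0 ∷ []) ∷ []
  ; G⁺                = (0 ∷ 11 ∷ 11 ∷ 11 ∷ 11 ∷ 11 ∷ 11 ∷ 0 ∷ 0 ∷ 0 ∷ []) ∷
                        (11 ∷ 0 ∷ 11 ∷ 11 ∷ 11 ∷ 0 ∷ 0 ∷ 11 ∷ 11 ∷ 0 ∷ []) ∷
                        (11 ∷ 11 ∷ 0 ∷ 11 ∷ 0 ∷ 11 ∷ 0 ∷ 11 ∷ 0 ∷ 11 ∷ []) ∷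
                        (11 ∷ 11 ∷ 11 ∷ 0 ∷ 0 ∷ 0 ∷ 11 ∷ 0 ∷ 11 ∷ 11 ∷ []) ∷
                        (11 ∷ 11 ∷ 0 ∷ 0 ∷ 0 ∷ 11 ∷ 11 ∷ 11 ∷ 11 ∷ 0 ∷ []) ∷
                        (11 ∷ 0 ∷ 11 ∷ 0 ∷ 11 ∷ 0 ∷ 11 ∷ 11 ∷ 0 ∷ 11 ∷ []) ∷
                        (11 ∷ 0 ∷ 0 ∷ 11 ∷ 11 ∷ 11 ∷ 0 ∷ 0 ∷ 11 ∷ 11 ∷ []) ∷
                        (0 ∷ 11 ∷ 11 ∷ 0 ∷ 11 ∷ 11 ∷ 0 ∷ 0 ∷ 11 ∷ 11 ∷ []) ∷
                        (0 ∷ 11 ∷ 0 ∷ 11 ∷ 11 ∷ 0 ∷ 11 ∷ 11 ∷ 0 ∷ 11 ∷ []) ∷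
                        (0 ∷ 0 ∷ 11 ∷ 11 ∷ 0 ∷ 11 ∷ 11 ∷ 11 ∷ 11 ∷ 0 ∷ []) ∷ []
  ; G⁻                = (49 ∷ 0 ∷ 0 ∷ 0 ∷ 0 ∷ 0 ∷ 0 ∷ 4 ∷ 4 ∷ 4 ∷ []) ∷
                        (0 ∷ 49 ∷ 0 ∷ 0 ∷ 0 ∷ 4 ∷ 4 ∷ 0 ∷ 0 ∷ 4 ∷ []) ∷
                        (0 ∷ 0 ∷ 49 ∷ 0 ∷ 4 ∷ 0 ∷ 4 ∷ 0 ∷ 4 ∷ 0 ∷ []) ∷
                        (0 ∷ 0 ∷ 0 ∷ 49 ∷ 4 ∷ 4 ∷ 0 ∷ 4 ∷ 0 ∷ 0 ∷ []) ∷
                        (0 ∷ 0 ∷ 4 ∷ 4 ∷ 49 ∷ 0 ∷ 0 ∷ 0 ∷ 0 ∷ 4 ∷ []) ∷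
                        (0 ∷ 4 ∷ 0 ∷ 4 ∷ 0 ∷ 49 ∷ 0 ∷ 0 ∷ 4 ∷ 0 ∷ []) ∷
                        (0 ∷ 4 ∷ 4 ∷ 0 ∷ 0 ∷ 0 ∷ 49 ∷ 4 ∷ 0 ∷ 0 ∷ []) ∷
                        (4 ∷ 0 ∷ 0 ∷ 4 ∷ 0 ∷ 0 ∷ 4 ∷ 49 ∷ 0 ∷ 0 ∷ []) ∷
                        (4 ∷ 0 ∷ 4 ∷ 0 ∷ 0 ∷ 4 ∷ 0 ∷ 0 ∷ 49 ∷ 0 ∷ []) ∷
                        (4 ∷ 4 ∷ 0 ∷ 0 ∷ 4 ∷ 0 ∷ 0 ∷ 0 ∷ 0 ∷ 49 ∷ []) ∷ []
  ; d                 = 1499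
  ; hessian₁-def      = by-evaluation refl
  ; left-inverse      = by-evaluation refl
  ; right-inverse     = by-evaluation refl
  }

data SmallCase : ℕ → ℕ → Set where
  K₄-3 : SmallCase 4 3
  K₅-3 : SmallCase 5 3
  K₅-4 : SmallCase 5 4

small-case : ∀ {n r} → n ≤ 5 → 2 < r → r < n → SmallCase n r
small-case (s≤s (s≤s (s≤s (s≤s z≤n))))       (s≤s (s≤s (s≤s z≤n)))       (s≤s (s≤s (s≤s (s≤s z≤n))))       = K₄-3
small-case (s≤s (s≤s (s≤s (s≤s (s≤s z≤n))))) (s≤s (s≤s (s≤s z≤n)))       (s≤s (s≤s (s≤s (s≤s z≤n))))       = K₅-3
small-case (s≤s (s≤s (s≤s (s≤s (s≤s z≤n))))) (s≤s (s≤s (s≤s z≤n)))       (s≤s (s≤s (s≤s (s≤s (s≤s z≤n))))) = K₅-4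

certificate : ∀ {n r} → SmallCase n r → Certificate n r
certificate K₄-3 = certificate₄₃
certificate K₅-3 = certificate₅₃
certificate K₅-4 = certificate₅₄

corollary3p8 : {c ℓ : Level} (K : CommutativeRing c ℓ) →
    Poly.IsField K → Poly.CharZero K →
    (n r : ℕ) → n ≤ 5 → 2 < r → r < n →
    (Φ : Poly.Coeffs K (#E n)) → Poly.IsBasisGenPoly K n r Φ →
    Poly.HasSLP K Φ × Poly.IsStrongLefschetzElement K Φ (Poly.sumVars K)
corollary3p8 K isField charZero n r n≤5 2<r r<n Φ Φ-gen = (Poly.sumVars K , sle) , sle
  where
  sle : Poly.IsStrongLefschetzElement K Φ (Poly.sumVars K)
  sle = certified-SLE (certificate (small-case n≤5 2<r r<n)) (ℕₚ.<⇒≤ 2<r) (ℕₚ.≤-pred (ℕₚ.≤-trans r<n n≤5))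
                      K isField charZero Φ Φ-gen
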